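{- For every connected graph $H$ (with at least three nodes, of constant size) and every $r \geq r_H$, where $r_H = \widetilde{\operatorname{diam}}(H) - 1$, the $r$-round bandwidth complexity of $\textsc{MemList}(H)$ under edge deletions is $O((\log n)/r)$.
   Context: Node-edge distance: $\operatorname{dist}_G(u,\{v,w\}) = 1 + \min\{\operatorname{dist}_G(u,v), \operatorname{dist}_G(u,w)\}$; $\widetilde{\operatorname{diam}}(G) = \max_{u \in V(G)} \max_{e \in E(G)} \operatorname{dist}_G(u,e)$. Dynamic network model: a sequence of graphs $G^0, G^1, \ldots$ on $n$ nodes, each obtained from the previous by at most one edge deletion; nodes have distinct IDs from $[n]$, know their neighbors' IDs and initially the whole of $G^0$; communication is synchronous, each round the change happens first, then each node sends a $B$-bit message to each neighbor; nodes detect changes only via their neighbor lists; algorithms are deterministic. An $r$-round algorithm works under the promise that each change at round $i$ is followed by $r-1$ change-free rounds and must output correctly for $G^i$ by the end of round $i+r-1$. The $r$-round bandwidth complexity is the minimum such $B$. $\textsc{MemList}(H)$: each node $v$ lists all subgraphs isomorphic to $H$ containing $v$. -}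

module Defs where

open import Data.Nat using (ℕ; zero; suc; _+_; _*_; _∸_; _≤_; _<_; _⊔_; _⊓_; _/_)
open import Data.Nat.Logarithm using (⌈log₂_⌉)
open import Data.Bool using (Bool; true; false; _∧_; _∨_; if_then_else_)
open import Data.Fin using (Fin; _≟_)
open import Data.List using (List; map; foldr; allFin)
open import Data.Maybe using (Maybe; just; nothing)
open import Data.Vec using (Vec)
open import Data.Product using (Σ; ∃; _×_; _,_)
open import Data.Sum using (_⊎_)
open import Relation.Nullary using (¬_; does)
open import Relation.Binary.PropositionalEquality using (_≡_)
open import Function using (_⇔_)
open import Function.Definitions using (Injective)

record Graph (n : ℕ) : Set where
  field
    adj     : Fin n → Fin n → Bool
    sym     : ∀ i j → adj i j ≡ adj j i
    irrefl  : ∀ i → adj i i ≡ false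
open Graph public

_≈G_ : ∀ {n} → Graph n → Graph n → Set
G ≈G G' = ∀ i j → adj G i j ≡ adj G' i j

AtMostOneDeletion : ∀ {n} → Graph n → Graph n → Set
AtMostOneDeletion {n} G G' =
  (G' ≈G G) ⊎
  (Σ (Fin n) λ x → Σ (Fin n) λ y → adj G x y ≡ true ×
     (∀ i j → (adj G' i j ≡ true) ⇔
        (adj G i j ≡ true × ¬ ((i ≡ x × j ≡ y) ⊎ (i ≡ y × j ≡ x)))))

any : ∀ {k} → (Fin k → Bool) → Bool
any f = foldr _∨_ false (map f (allFin _))

maxOver : ∀ {k} → (Fin k → ℕ) → ℕ
maxOver f = foldr _⊔_ 0 (map f (allFin _))

eqB : ∀ {k} → Fin k → Fin k → Bool
eqB u v = does (u ≟ v)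

reachWithin : ∀ {k} → Graph k → ℕ → Fin k → Fin k → Bool
reachWithin H zero    u v = eqB u v
reachWithin H (suc d) u v =
  reachWithin H d u v ∨ any (λ w → reachWithin H d u w ∧ adj H w v)

Connected : ∀ {k} → Graph k → Set
Connected {k} H = ∀ u v → Σ ℕ λ d → reachWithin H d u v ≡ true

-- least d ≤ bound with reachWithin d, searching upward from d
-- (returns the bound if none is found)
searchDist : ∀ {k} → Graph k → Fin k → Fin k → ℕ → ℕ → ℕ
searchDist H u v d zero = d
searchDist H u v d (suc fuel) =
  if reachWithin H d u v then d else searchDist H u v (suc d) fuel

-- shortest-path distance (in a graph on k nodes every distance is < k)
dist : ∀ {k} → Graph k → Fin k → Fin k → ℕ
dist {k} H u v = searchDist H u v 0 k

nodeEdgeDist : ∀ {k} → Graph k → Fin k → Fin k → Fin k → ℕ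
nodeEdgeDist H u v w = suc (dist H u v ⊓ dist H u w)

diamTilde : ∀ {k} → Graph k → ℕ
diamTilde H = maxOver λ u → maxOver λ v → maxOver λ w →
  if adj H v w then nodeEdgeDist H u v w else 0

rH : ∀ {k} → Graph k → ℕ
rH H = diamTilde H ∸ 1

-- F (a subgraph given by its edge set; its vertex set = non-isolated
-- vertices) is isomorphic to H via an injective f whose image contains
-- every endpoint of an edge of F
IsoCopy : ∀ {n k} → Graph n → Graph k → Set
IsoCopy {n} {k} F H =
  Σ (Fin k → Fin n) λ f →
    Injective _≡_ _≡_ f ×
    (∀ a b → adj F (f a) (f b) ≡ adj H a b) ×
    (∀ i j → adj F i j ≡ true → ∃ λ a → f a ≡ i)

_⊆G_ : ∀ {n} → Graph n → Graph n → Set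
F ⊆G G = ∀ i j → adj F i j ≡ true → adj G i j ≡ true

Contains : ∀ {n} → Graph n → Fin n → Set
Contains F v = ∃ λ u → adj F v u ≡ true

MemListCopy : ∀ {n k} → Graph k → Graph n → Fin n → Graph n → Set
MemListCopy H G v F = F ⊆G G × Contains F v × IsoCopy F H

Msg : ℕ → Set
Msg B = Vec Bool B

record Algorithm (n B : ℕ) : Set₁ where
  field
    State : Set
    -- initial state from own ID and the whole initial graph G⁰
    init  : Fin n → Graph n → State
    -- message to neighbour u, given state and current neighbour list
    send  : State → (Fin n → Bool) → Fin n → Msg B
    -- new state from state, current neighbour list, received messages
    step  : State → (Fin n → Bool) → (Fin n → Maybe (Msg B)) → State
    -- output: the set of listed subgraphs (characteristic function)
    out   : State → Graph n → Bool
open Algorithm public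

DynSeq : ℕ → Set
DynSeq n = ℕ → Graph n

EdgeDeletionSeq : ∀ {n} → DynSeq n → Set
EdgeDeletionSeq G = ∀ t → AtMostOneDeletion (G t) (G (suc t))

-- promise: a change at round i+1 is followed by r-1 change-free rounds
Promise : ∀ {n} → ℕ → DynSeq n → Set
Promise r G = ∀ i d → 1 ≤ d → d < r →
  ¬ (G (suc i) ≈G G i) → G (suc (i + d)) ≈G G (i + d)

-- state of every node at the end of round t (t = 0: initial state)
run : ∀ {n B} (A : Algorithm n B) → DynSeq n → ℕ → Fin n → State A
run A G zero v = init A v (G zero)
run A G (suc t) v =
  step A (run A G t v) (adj (G (suc t)) v)
    (λ u → if adj (G (suc t)) v u
             then just (send A (run A G t u) (adj (G (suc t)) u) v)
             else nothing)

CorrectOutput : ∀ {n k} → Graph k → Graph n → Fin n → Bool → Graph n → Set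
CorrectOutput H G v b F = (b ≡ true) ⇔ MemListCopy H G v F

-- A is an r-round algorithm for MemList(H) under edge deletions: whenever
-- the last change happened at round ≤ t-r+1 (i.e. G^{t-(r-1)} = G^t), every
-- node's output at the end of round t is correct for G^t
SolvesMemList : ∀ {n k B} → Graph k → ℕ → Algorithm n B → Set
SolvesMemList {n} H r A =
  (G : DynSeq n) → EdgeDeletionSeq G → Promise r G →
  ∀ t → G (t ∸ (r ∸ 1)) ≈G G t →
  ∀ v F → CorrectOutput H (G t) v (out A (run A G t v) F) F

ceilDiv : ℕ → ℕ → ℕ
ceilDiv a zero = 0
ceilDiv a (suc m) = (a + m) / suc m

-- Every node keeps G⁰ and a list D of edges it knows to be deleted, and lists the copies of H in G⁰ - D.
-- When an edge disappears, both endpoints announce it and the packet (the edge, a hop count) is flooded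
-- for R = rH H hops, one hop per phase of m rounds, each phase sending the O(log n)-bit packet in m
-- chunks. By the promise at most one packet circulates at a time, so OR-ing the chunks received from all
-- neighbours loses nothing, and r rounds after a deletion everything is quiet again.
-- Invariant: every node's view K = G⁰ - D contains G^t, and no deleted edge of K lies within R hops of v
-- in K. This suffices: each node of a copy of H is within node-edge distance diam~(H) = R + 1 of each
-- edge of the copy, so a copy through v in K that used a deleted edge would contain a deleted edge of K
-- within R hops of v.
module Submission where

open import Defs
open import Data.Nat using (ℕ; zero; suc; _+_; _*_; _∸_; _≤_; _<_; _⊔_; _⊓_; _/_; _%_; _≤ᵇ_; _<ᵇ_; _≡ᵇ_; _^_; z≤n; s≤s; pred; ⌈_/2⌉)
open import Data.Nat.Properties using (≤-refl; ≤-trans; ≤-reflexive; n≤1+n; m≤m+n; m≤n+m; +-comm; +-assoc; *-comm; +-suc; <⇒≤; ≤-pred; m≤m⊔n; m≤n⊔m; ≮⇒≥; <-irrefl; +-monoʳ-≤; +-monoˡ-≤; *-monoʳ-≤; *-monoˡ-≤; ≤ᵇ⇒≤; ≤⇒≤ᵇ; m∸n+n≡m; +-identityʳ; *-identityʳ; ≤-antisym; <-≤-trans; ≤-<-trans; m≤n⇒m<n∨m≡n; ⊓-sel; m≤n+o⇒m∸n≤o; ≤∧≢⇒<; n≤0⇒n≡0; ⊓-glb; *-suc; *-cancelˡ-<; m+[n∸m]≡n; ≤-total; ≡ᵇ⇒≡; ≡⇒≡ᵇ; <ᵇ⇒<; <⇒<ᵇ; +-cancelʳ-≡; +-cancelʳ-<;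 m∸n≤m; +-monoʳ-<; ⌈n/2⌉<n; +-cancelˡ-≤; *-identityˡ; m+n∸n≡m; m<n⇒0<n∸m; ≰⇒>; _≤?_; _<?_; module ≤-Reasoning)
open import Data.Nat.Logarithm using (⌈log₂_⌉; ⌈log₂⌉-mono-≤)
open import Data.Nat.Logarithm.Core using (⌈log2⌉)
open import Data.Nat.DivMod using (m≡m%n+[m/n]*n; m%n<n; m/n*n≤m; m≥n⇒m/n>0)
open import Data.Nat.Induction using (<-wellFounded)
open import Data.Nat.Tactic.RingSolver using (solve-∀)
open import Induction.WellFounded using (Acc) renaming (acc to accW)
open import Data.Bool using (Bool; true; false; _∧_; _∨_; not; if_then_else_; T)
open import Data.Bool.Properties using (∨-comm; ∨-assoc; ∨-identityʳ; ∨-zeroʳ; ∧-identityʳ; ∧-zeroʳ; ∧-comm; ∨-idem; ∧-inverseʳ; T-≡; T-not-≡) renaming (_≟_ to _≟B_)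
open import Data.Fin using (Fin; toℕ; fromℕ<) renaming (zero to fz; suc to fs)
open import Data.Fin.Properties using (toℕ-injective; toℕ<n; fromℕ<-toℕ; any?; all?) renaming (_≟_ to _≟F_)
open import Data.List using (List; []; _∷_; map; foldr; allFin; _++_; length; take; drop)
import Data.List as List
open import Data.List.Properties using (++-assoc; map-++; length-++)
open import Data.List.Membership.Propositional using (_∈_)
open import Data.List.Membership.Propositional.Properties using (∈-allFin)
open import Data.List.Relation.Unary.Any using (here; there)
open import Data.Maybe using (Maybe; just; nothing; _<∣>_)
open import Data.Maybe.Properties using (<∣>-identityʳ)
open import Data.Vec using (Vec; []; _∷_; replicate; toList)
open import Data.Product using (Σ; ∃; _×_; _,_; proj₁; proj₂)
open import Data.Sum using (_⊎_; inj₁; inj₂)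
open import Data.Empty using (⊥; ⊥-elim)
open import Data.Unit using (⊤; tt)
open import Relation.Nullary using (¬_; Dec; yes; no; does; ¬?)
open import Relation.Nullary.Decidable using (_×-dec_; _→-dec_)
open import Relation.Binary.PropositionalEquality using (_≡_; _≢_; refl; trans; cong; cong₂; subst; module ≡-Reasoning) renaming (sym to ≡sym)
open import Function using (_⇔_; id; mk⇔; Equivalence)
open import Function.Properties.Equivalence using () renaming (trans to ⇔-trans; sym to ⇔-sym)
open import Function.Definitions using (Injective)

∧-elim : ∀ {a b} → a ∧ b ≡ true → a ≡ true × b ≡ true
∧-elim {true} {true} _ = refl , refl

∧-intro : ∀ {a b} → a ≡ true → b ≡ true → a ∧ b ≡ true
∧-intro refl refl = refl

∨-elim : ∀ {a b} → a ∨ b ≡ true → a ≡ true ⊎ b ≡ true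
∨-elim {true} _ = inj₁ refl
∨-elim {false} p = inj₂ p

∨-introˡ : ∀ {a} b → a ≡ true → a ∨ b ≡ true
∨-introˡ b refl = refl

∨-introʳ : ∀ a {b} → b ≡ true → a ∨ b ≡ true
∨-introʳ true _ = refl
∨-introʳ false p = p

∨-false : ∀ {a b} → a ≡ false → b ≡ false → a ∨ b ≡ false
∨-false refl refl = refl

¬true⇒false : ∀ {a} → ¬ (a ≡ true) → a ≡ false
¬true⇒false {false} _ = refl
¬true⇒false {true} p = ⊥-elim (p refl)

t≢f : ∀ {a} → a ≡ true → a ≡ false → ⊥
t≢f refl ()

∧-not-≡ : ∀ {a b} → a ≡ b → a ∧ not b ≡ false
∧-not-≡ {a} refl = ∧-inverseʳ a

eqB-true : ∀ {k} {u v : Fin k} → eqB u v ≡ true → u ≡ v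
eqB-true {u = u} {v} p with u ≟F v
... | yes e = e
... | no _ = ⊥-elim (t≢f p refl)

eqB-refl : ∀ {k} (u : Fin k) → eqB u u ≡ true
eqB-refl u with u ≟F u
... | yes _ = refl
... | no ne = ⊥-elim (ne refl)

eqB-false : ∀ {k} {u v : Fin k} → u ≢ v → eqB u v ≡ false
eqB-false {u = u} {v} ne with u ≟F v
... | yes e = ⊥-elim (ne e)
... | no _ = refl

module _ {A : Set} where
  anyL : (A → Bool) → List A → Bool
  anyL f xs = foldr _∨_ false (map f xs)

  anyL-true : ∀ f xs → anyL f xs ≡ true → ∃ λ u → f u ≡ true
  anyL-true f (x ∷ xs) p with ∨-elim {f x} p
  ... | inj₁ q = x , q
  ... | inj₂ q = anyL-true f xs q

  anyL-intro : ∀ f xs u → u ∈ xs → f u ≡ true → anyL f xs ≡ true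
  anyL-intro f (x ∷ xs) u (here refl) q = ∨-introˡ _ q
  anyL-intro f (x ∷ xs) u (there m) q = ∨-introʳ (f x) (anyL-intro f xs u m q)

  anyL-false : ∀ f xs → (∀ u → f u ≡ false) → anyL f xs ≡ false
  anyL-false f [] h = refl
  anyL-false f (x ∷ xs) h = ∨-false (h x) (anyL-false f xs h)

  anyL-cong : ∀ f g xs → (∀ u → f u ≡ g u) → anyL f xs ≡ anyL g xs
  anyL-cong f g [] h = refl
  anyL-cong f g (x ∷ xs) h = cong₂ _∨_ (h x) (anyL-cong f g xs h)

any-true : ∀ {k} (f : Fin k → Bool) → any f ≡ true → ∃ λ u → f u ≡ true
any-true f = anyL-true f (allFin _)

any-intro : ∀ {k} (f : Fin k → Bool) u → f u ≡ true → any f ≡ true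
any-intro f u = anyL-intro f (allFin _) u (∈-allFin u)

any-false : ∀ {k} (f : Fin k → Bool) → (∀ u → f u ≡ false) → any f ≡ false
any-false f = anyL-false f (allFin _)

any-cong : ∀ {k} (f g : Fin k → Bool) → (∀ u → f u ≡ g u) → any f ≡ any g
any-cong f g = anyL-cong f g (allFin _)


walk : ∀ {n} → (Fin n → Fin n → Bool) → (Fin n → Bool) → ℕ → Fin n → Bool
walk A T zero w = T w
walk A T (suc h) w = any (λ u → A w u ∧ walk A T h u)

walk-map : ∀ {k n} (A : Fin k → Fin k → Bool) (A' : Fin n → Fin n → Bool)
  (T : Fin k → Bool) (T' : Fin n → Bool) (f : Fin k → Fin n) →
  (∀ a b → A a b ≡ true → A' (f a) (f b) ≡ true) →
  (∀ z → T z ≡ true → T' (f z) ≡ true) →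
  ∀ h u → walk A T h u ≡ true → walk A' T' h (f u) ≡ true
walk-map A A' T T' f hA hT zero u p = hT u p
walk-map A A' T T' f hA hT (suc h) u p with any-true _ p
... | z , q with ∧-elim {A u z} q
... | q1 , q2 = any-intro _ (f z) (∧-intro (hA u z q1) (walk-map A A' T T' f hA hT h z q2))

walk-mono : ∀ {n} (A A' : Fin n → Fin n → Bool) (T T' : Fin n → Bool) →
  (∀ a b → A a b ≡ true → A' a b ≡ true) →
  (∀ z → T z ≡ true → T' z ≡ true) →
  ∀ h u → walk A T h u ≡ true → walk A' T' h u ≡ true
walk-mono A A' T T' hA hT = walk-map A A' T T' id hA hT

walk-snoc : ∀ {n} (A : Fin n → Fin n → Bool) (a b : Fin n) → A a b ≡ true →
  ∀ h u → walk A (eqB a) h u ≡ true → walk A (eqB b) (suc h) u ≡ true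
walk-snoc A a b ab zero u p with eqB-true {u = a} p
... | refl = any-intro _ b (∧-intro ab (eqB-refl b))
walk-snoc A a b ab (suc h) u p with any-true _ p
... | z , q with ∧-elim {A u z} q
... | q1 , q2 = any-intro _ z (∧-intro q1 (walk-snoc A a b ab h z q2))


walk-or-missing-edge : ∀ {n} (A A' : Fin n → Fin n → Bool) a h w → walk A (eqB a) h w ≡ true →
  (walk A' (eqB a) h w ≡ true) ⊎
  (Σ (Fin n) λ c → Σ (Fin n) λ d → Σ ℕ λ h' → h' ≤ h × walk A' (eqB c) h' w ≡ true × A c d ≡ true × A' c d ≡ false)
walk-or-missing-edge A A' a zero w p = inj₁ p
walk-or-missing-edge A A' a (suc h) w p with any-true _ p
... | z , q with ∧-elim {A w z} q
... | q1 , q2 with A' w z in e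
... | false = inj₂ (w , z , 0 , z≤n , eqB-refl w , q1 , e)
... | true with walk-or-missing-edge A A' a h z q2
... | inj₁ r = inj₁ (any-intro _ z (∧-intro e r))
... | inj₂ (c , d , h' , le , wc , Acd , A'cd) = inj₂ (c , d , suc h' , s≤s le , any-intro _ z (∧-intro e wc) , Acd , A'cd)

reachWithin⇒walk : ∀ {k} (H : Graph k) d u v → reachWithin H d u v ≡ true →
  ∃ λ h → h ≤ d × walk (adj H) (eqB v) h u ≡ true
reachWithin⇒walk H zero u v p with eqB-true {u = u} p
... | refl = 0 , z≤n , eqB-refl u
reachWithin⇒walk H (suc d) u v p with ∨-elim {reachWithin H d u v} p
... | inj₁ q with reachWithin⇒walk H d u v q
... | h , le , w = h , ≤-trans le (n≤1+n d) , w
reachWithin⇒walk H (suc d) u v p | inj₂ q with any-true _ q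
... | w , q' with ∧-elim {reachWithin H d u w} q'
... | q1 , q2 with reachWithin⇒walk H d u w q1
... | h , le , wl = suc h , s≤s le , walk-snoc (adj H) w v q2 h u wl

count : ∀ {k} → (Fin k → Bool) → ℕ
count {zero} f = 0
count {suc k} f = (if f fz then 1 else 0) + count (λ i → f (fs i))

count-mono : ∀ {k} (f g : Fin k → Bool) → (∀ v → f v ≡ true → g v ≡ true) → count f ≤ count g
count-mono {zero} f g h = z≤n
count-mono {suc k} f g h with f fz in e1 | g fz in e2
... | true | true = s≤s (count-mono _ _ (λ v → h (fs v)))
... | true | false = ⊥-elim (t≢f (h fz e1) e2)
... | false | true = ≤-trans (count-mono (λ i → f (fs i)) _ (λ v → h (fs v))) (n≤1+n _)
... | false | false = count-mono _ _ (λ v → h (fs v))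

count-< : ∀ {k} (f g : Fin k → Bool) → (∀ v → f v ≡ true → g v ≡ true) →
  ∀ w → f w ≡ false → g w ≡ true → suc (count f) ≤ count g
count-< {suc k} f g h fz p q rewrite p | q = s≤s (count-mono _ _ (λ v → h (fs v)))
count-< {suc k} f g h (fs w) p q with f fz in e1 | g fz in e2
... | true | true = s≤s (count-< _ _ (λ v → h (fs v)) w p q)
... | true | false = ⊥-elim (t≢f (h fz e1) e2)
... | false | true = s≤s (≤-trans (n≤1+n _) (count-< (λ i → f (fs i)) _ (λ v → h (fs v)) w p q))
... | false | false = count-< _ _ (λ v → h (fs v)) w p q

count-≤ : ∀ {k} (f : Fin k → Bool) → count f ≤ k
count-≤ {zero} f = z≤n
count-≤ {suc k} f with f fz
... | true = s≤s (count-≤ _)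
... | false = ≤-trans (count-≤ (λ i → f (fs i))) (n≤1+n k)

count<k : ∀ {k} (f : Fin k → Bool) w → f w ≡ false → suc (count f) ≤ k
count<k {suc k} f fz p rewrite p = s≤s (count-≤ _)
count<k {suc k} f (fs w) p with f fz
... | true = s≤s (count<k _ w p)
... | false = s≤s (≤-trans (n≤1+n _) (count<k (λ i → f (fs i)) w p))

count-pos : ∀ {k} (f : Fin k → Bool) w → f w ≡ true → 1 ≤ count f
count-pos {suc k} f fz p rewrite p = s≤s z≤n
count-pos {suc k} f (fs w) p with f fz
... | true = s≤s z≤n
... | false = count-pos _ w p

strengthen-⇒ : ∀ {a b} → (a ≡ true → b ≡ true) → b ≢ a → a ≡ false × b ≡ true
strengthen-⇒ {false} {true} _ _ = refl , refl
strengthen-⇒ {false} {false} _ ne = ⊥-elim (ne refl)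
strengthen-⇒ {true} {b} m ne = ⊥-elim (ne (m refl))

-- The sets R j grow strictly until they are stable; having at most k elements, they are stable from k - 1 on.
module ReachSets {k} (H : Graph k) (u : Fin k) where
  R : ℕ → Fin k → Bool
  R j v = reachWithin H j u v

  R-mono1 : ∀ j v → R j v ≡ true → R (suc j) v ≡ true
  R-mono1 j v p = ∨-introˡ _ p

  R-mono : ∀ j l v → R j v ≡ true → R (l + j) v ≡ true
  R-mono j zero v p = p
  R-mono j (suc l) v p = R-mono1 (l + j) v (R-mono j l v p)

  Stable : ℕ → Set
  Stable j = ∀ l v → R (l + j) v ≡ R j v

  stable-step : ∀ j → (∀ v → R (suc j) v ≡ R j v) → ∀ v → R (suc (suc j)) v ≡ R (suc j) v
  stable-step j h v = begin
      R (suc j) v ∨ any (λ w → R (suc j) w ∧ adj H w v)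
        ≡⟨ cong (R (suc j) v ∨_) (any-cong _ _ (λ w → cong (_∧ adj H w v) (h w))) ⟩
      (R j v ∨ X) ∨ X ≡⟨ ∨-assoc (R j v) X X ⟩
      R j v ∨ (X ∨ X) ≡⟨ cong (R j v ∨_) (∨-idem X) ⟩
      R (suc j) v ∎
    where
    open ≡-Reasoning
    X = any (λ w → R j w ∧ adj H w v)

  stable-from : ∀ j → (∀ v → R (suc j) v ≡ R j v) → Stable j
  stable-from j h zero v = refl
  stable-from j h (suc l) v = trans (go l v) (stable-from j h l v)
    where
    go : ∀ l v → R (suc l + j) v ≡ R (l + j) v
    go zero v = h v
    go (suc l) v = stable-step (l + j) (go l) v

  stable-suc : ∀ j → Stable j → Stable (suc j)
  stable-suc j s l v = trans (subst (λ z → R z v ≡ R j v) (≡sym (+-suc l j)) (s (suc l) v)) (≡sym (s 1 v))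

  grows-or-stable : ∀ j → (suc j ≤ count (R j)) ⊎ Stable j
  grows-or-stable zero = inj₁ (count-pos (R 0) u (eqB-refl u))
  grows-or-stable (suc j) with grows-or-stable j
  ... | inj₂ s = inj₂ (stable-suc j s)
  ... | inj₁ c with any? (λ v → ¬? (R (suc j) v ≟B R j v))
  ... | no none = inj₂ (stable-suc j (stable-from j (λ v → decide v)))
    where
    decide : ∀ v → R (suc j) v ≡ R j v
    decide v with R (suc j) v ≟B R j v
    ... | yes e = e
    ... | no ne = ⊥-elim (none (v , ne))
  ... | yes (w , ne) with strengthen-⇒ (R-mono1 j w) ne
  ... | rjw , rsjw = inj₁ (≤-trans (s≤s c) (count-< (R j) (R (suc j)) (R-mono1 j) w rjw rsjw))

  reachWithin-saturates : ∀ k' → k ≡ suc k' → ∀ d v → R d v ≡ true → R k' v ≡ true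
  reachWithin-saturates k' ek d v p with grows-or-stable k'
  ... | inj₁ c with R k' v in e
  ... | true = refl
  ... | false = ⊥-elim (<-irrefl refl (≤-trans (s≤s c) (subst (suc (count (R k')) ≤_) ek (count<k (R k') v e))))
  reachWithin-saturates k' ek d v p | inj₂ s with d ≤? k'
  ... | yes le = subst (λ z → R z v ≡ true) (m∸n+n≡m le) (R-mono d (k' ∸ d) v p)
  ... | no nle = trans (≡sym (s (d ∸ k') v)) (subst (λ z → R z v ≡ true) (≡sym (m∸n+n≡m (<⇒≤ (≮⇒≥ λ lt → nle (≤-pred lt))))) p)

  searchDist-spec : ∀ v d fuel → (reachWithin H (searchDist H u v d fuel) u v ≡ true) ⊎
    (∀ j → d ≤ j → j < d + fuel → R j v ≡ false)
  searchDist-spec v d zero = inj₂ λ j le lt → ⊥-elim (<-irrefl refl (≤-<-trans le (subst (j <_) (+-identityʳ d) lt)))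
  searchDist-spec v d (suc fuel) with reachWithin H d u v in e
  ... | true = inj₁ e
  ... | false with searchDist-spec v (suc d) fuel
  ... | inj₁ q = inj₁ q
  ... | inj₂ h = inj₂ λ j le lt → case j le lt
    where
    case : ∀ j → d ≤ j → j < d + suc fuel → R j v ≡ false
    case j le lt with m≤n⇒m<n∨m≡n le
    ... | inj₂ refl = e
    ... | inj₁ dl = h j dl (subst (j <_) (+-suc d fuel) lt)

reachWithin-dist : ∀ {k} (H : Graph k) → Connected H → ∀ u v → reachWithin H (dist H u v) u v ≡ true
reachWithin-dist {suc k'} H con u v with ReachSets.searchDist-spec H u v 0 (suc k')
... | inj₁ q = q
... | inj₂ h with con u v
... | d , p = ⊥-elim (t≢f (ReachSets.reachWithin-saturates H u k' refl d v p) (h k' z≤n ≤-refl))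


maxL-≥ : ∀ {A : Set} (f : A → ℕ) xs x → x ∈ xs → f x ≤ foldr _⊔_ 0 (map f xs)
maxL-≥ f (y ∷ xs) x (here refl) = m≤m⊔n (f x) _
maxL-≥ f (y ∷ xs) x (there m) = ≤-trans (maxL-≥ f xs x m) (m≤n⊔m (f y) _)

maxOver-≥ : ∀ {k} (f : Fin k → ℕ) x → f x ≤ maxOver f
maxOver-≥ f x = maxL-≥ f (allFin _) x (∈-allFin x)

nodeEdgeDist≤diamTilde : ∀ {k} (H : Graph k) u a b → adj H a b ≡ true →
  suc (dist H u a ⊓ dist H u b) ≤ diamTilde H
nodeEdgeDist≤diamTilde H u a b e =
  ≤-trans (≤-reflexive (≡sym (cong (λ z → if z then nodeEdgeDist H u a b else 0) e)))
  (≤-trans (maxOver-≥ (λ w → if adj H a w then nodeEdgeDist H u a w else 0) b)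
  (≤-trans (maxOver-≥ (λ v → maxOver λ w → if adj H v w then nodeEdgeDist H u v w else 0) a)
  (maxOver-≥ (λ u → maxOver λ v → maxOver λ w → if adj H v w then nodeEdgeDist H u v w else 0) u)))

suc≤⇒≤∸1 : ∀ {m d} → suc m ≤ d → m ≤ d ∸ 1
suc≤⇒≤∸1 (s≤s p) = p

walk-to-edge≤rH : ∀ {k} (H : Graph k) → Connected H → ∀ a b → adj H a b ≡ true → ∀ u →
  (∃ λ h → h ≤ rH H × walk (adj H) (eqB a) h u ≡ true) ⊎
  (∃ λ h → h ≤ rH H × walk (adj H) (eqB b) h u ≡ true)
walk-to-edge≤rH H con a b e u with ⊓-sel (dist H u a) (dist H u b)
... | inj₁ eq with reachWithin⇒walk H _ u a (reachWithin-dist H con u a)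
... | h , le , w = inj₁ (h , ≤-trans le (subst (_≤ rH H) eq (suc≤⇒≤∸1 (nodeEdgeDist≤diamTilde H u a b e))) , w)
walk-to-edge≤rH H con a b e u | inj₂ eq with reachWithin⇒walk H _ u b (reachWithin-dist H con u b)
... | h , le , w = inj₂ (h , ≤-trans le (subst (_≤ rH H) eq (suc≤⇒≤∸1 (nodeEdgeDist≤diamTilde H u a b e))) , w)

searchDist-≥ : ∀ {k} (H : Graph k) u v d fuel → d ≤ searchDist H u v d fuel
searchDist-≥ H u v d zero = ≤-refl
searchDist-≥ H u v d (suc fuel) with reachWithin H d u v
... | true = ≤-refl
... | false = ≤-trans (n≤1+n d) (searchDist-≥ H u v (suc d) fuel)

dist≥1 : ∀ {k} (H : Graph k) u v → u ≢ v → 1 ≤ dist H u v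
dist≥1 {suc k} H u v ne with eqB-false ne
... | e = subst (λ z → 1 ≤ (if z then 0 else searchDist H u v 1 k)) (≡sym e) (searchDist-≥ H u v 1 k)

rH≥1 : ∀ {k} (H : Graph k) → Connected H → 3 ≤ k → 1 ≤ rH H
rH≥1 {suc zero} H con (s≤s ())
rH≥1 {suc (suc zero)} H con (s≤s (s≤s ()))
rH≥1 {suc (suc (suc k))} H con _ with con fz (fs fz)
... | d , p with reachWithin⇒walk H d fz (fs fz) p
... | zero , _ , w = ⊥-elim (t≢f w refl)
... | suc h , _ , w with any-true _ w
... | z , q with ∧-elim {adj H fz z} q
... | q1 , _ = suc≤⇒≤∸1 (≤-trans (s≤s (⊓-glb (dist≥1 H u fz nu0) (dist≥1 H u z nuz))) (nodeEdgeDist≤diamTilde H u fz z q1))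
  where
  pick : Σ (Fin (suc (suc (suc k)))) λ u → u ≢ fz × u ≢ z
  pick with z ≟F fs fz
  ... | yes refl = fs (fs fz) , (λ ()) , (λ ())
  ... | no ne = fs fz , (λ ()) , (λ e → ne (≡sym e))
  u = proj₁ pick
  nu0 = proj₁ (proj₂ pick)
  nuz = proj₂ (proj₂ pick)


consF : ∀ {k n} → Fin n → (Fin k → Fin n) → Fin (suc k) → Fin n
consF a g fz = a
consF a g (fs x) = g x

∃-fun? : ∀ k n (P : (Fin k → Fin n) → Set) →
  (∀ f g → (∀ x → f x ≡ g x) → P f → P g) → (∀ f → Dec (P f)) → Dec (Σ (Fin k → Fin n) P)
∃-fun? zero n P ext dec with dec (λ ())
... | yes p = yes ((λ ()) , p)
... | no np = no λ { (f , p) → np (ext f (λ ()) (λ ()) p) }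
∃-fun? (suc k) n P ext dec with any? (λ a → ∃-fun? k n (λ g → P (consF a g))
    (λ f g e p → ext (consF a f) (consF a g) (λ { fz → refl ; (fs x) → e x }) p) (λ g → dec (consF a g)))
... | yes (a , g , p) = yes (consF a g , p)
... | no np = no λ { (f , p) → np (f fz , (λ x → f (fs x)) ,
          ext f (consF (f fz) (λ x → f (fs x))) (λ { fz → refl ; (fs x) → refl }) p) }

module _ {n k : ℕ} (H : Graph k) where
  IsIsoMap : Graph n → (Fin k → Fin n) → Set
  IsIsoMap F f = Injective _≡_ _≡_ f ×
    (∀ a b → adj F (f a) (f b) ≡ adj H a b) ×
    (∀ i j → adj F i j ≡ true → ∃ λ a → f a ≡ i)

  IsIsoMap-ext : ∀ F f g → (∀ x → f x ≡ g x) → IsIsoMap F f → IsIsoMap F g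
  IsIsoMap-ext F f g e (inj , ad , sur) =
    (λ {x} {y} q → inj (trans (e x) (trans q (≡sym (e y))))) ,
    (λ a b → subst₂' (ad a b)) ,
    (λ i j q → let (a , fa) = sur i j q in a , trans (≡sym (e a)) fa)
    where
    subst₂' : ∀ {a b} → adj F (f a) (f b) ≡ adj H a b → adj F (g a) (g b) ≡ adj H a b
    subst₂' {a} {b} q rewrite ≡sym (e a) | ≡sym (e b) = q

  injective? : ∀ (f : Fin k → Fin n) → Dec (Injective _≡_ _≡_ f)
  injective? f with all? (λ x → all? (λ y → (f x ≟F f y) →-dec (x ≟F y)))
  ... | yes p = yes λ {x} {y} q → p x y q
  ... | no np = no λ inj → np (λ x y q → inj q)

  isIsoMap? : ∀ F f → Dec (IsIsoMap F f)
  isIsoMap? F f = injective? f ×-dec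
    all? (λ a → all? (λ b → adj F (f a) (f b) ≟B adj H a b)) ×-dec
    all? (λ i → all? (λ j → (adj F i j ≟B true) →-dec any? (λ a → f a ≟F i)))

  isoCopy? : ∀ F → Dec (IsoCopy F H)
  isoCopy? F = ∃-fun? k n (IsIsoMap F) (IsIsoMap-ext F) (isIsoMap? F)

  memListCopy? : ∀ (K : Graph n) v F → Dec (MemListCopy H K v F)
  memListCopy? K v F =
    all? (λ i → all? (λ j → (adj F i j ≟B true) →-dec (adj K i j ≟B true))) ×-dec
    any? (λ u → adj F v u ≟B true) ×-dec
    isoCopy? F


StaleFree : ∀ {n} → ℕ → Graph n → (Fin n → Fin n → Bool) → Fin n → Set
StaleFree R G A v = ∀ a b → A a b ≡ true → adj G a b ≡ false → ∀ h → h ≤ R → walk A (eqB a) h v ≡ false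

eqB-map : ∀ {k n} (f : Fin k → Fin n) a z → eqB a z ≡ true → eqB (f a) (f z) ≡ true
eqB-map f a z p with eqB-true {u = a} p
... | refl = eqB-refl (f a)

module _ {n k} (H : Graph k) (con : Connected H) (Gt K : Graph n) (v : Fin n)
  (sub : ∀ i j → adj Gt i j ≡ true → adj K i j ≡ true) (sf : StaleFree (rH H) Gt (adj K) v) where

  copy-edge-survives : ∀ F → F ⊆G K → Contains F v → IsoCopy F H → ∀ i j → adj F i j ≡ true → adj Gt i j ≡ true
  copy-edge-survives F FK (w , vw) (f , inj , ad , sur) i j Fij with adj Gt i j in eG
  ... | true = refl
  ... | false with sur i j Fij | sur j i (trans (sym F j i) Fij) | sur v w vw
  ... | a , refl | b , refl | u , refl = ⊥-elim (go (walk-to-edge≤rH H con a b Hab u))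
    where
    Hab : adj H a b ≡ true
    Hab = trans (≡sym (ad a b)) Fij
    hA : ∀ x y → adj H x y ≡ true → adj K (f x) (f y) ≡ true
    hA x y q = FK (f x) (f y) (trans (ad x y) q)
    go : (∃ λ h → h ≤ rH H × walk (adj H) (eqB a) h u ≡ true) ⊎
         (∃ λ h → h ≤ rH H × walk (adj H) (eqB b) h u ≡ true) → ⊥
    go (inj₁ (h , le , wl)) = t≢f (walk-map (adj H) (adj K) (eqB a) (eqB (f a)) f hA (eqB-map f a) h u wl)
                                  (sf (f a) (f b) (FK _ _ Fij) eG h le)
    go (inj₂ (h , le , wl)) = t≢f (walk-map (adj H) (adj K) (eqB b) (eqB (f b)) f hA (eqB-map f b) h u wl)
                                  (sf (f b) (f a) (trans (sym K (f b) (f a)) (FK _ _ Fij)) (trans (sym Gt (f b) (f a)) eG) h le)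

  memListCopy-stale-free : ∀ F → MemListCopy H Gt v F ⇔ MemListCopy H K v F
  memListCopy-stale-free F = mk⇔ (λ { (FG , c , iso) → (λ i j q → sub i j (FG i j q)) , c , iso })
                (λ { (FK , c , iso) → copy-edge-survives F FK c iso , c , iso })


half : ℕ → ℕ × Bool
half zero = 0 , false
half (suc zero) = 0 , true
half (suc (suc x)) = suc (proj₁ (half x)) , proj₂ (half x)

bit : Bool → ℕ
bit true = 1
bit false = 0

half-spec : ∀ x → x ≡ bit (proj₂ (half x)) + 2 * proj₁ (half x)
half-spec zero = refl
half-spec (suc zero) = refl
half-spec (suc (suc x)) = begin
    suc (suc x) ≡⟨ cong (λ z → suc (suc z)) (half-spec x) ⟩
    suc (suc (bit b + 2 * q)) ≡⟨ ≡sym (trans (cong (bit b +_) (*-suc 2 q)) (trans (+-suc (bit b) (suc (2 * q))) (cong suc (+-suc (bit b) (2 * q))))) ⟩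
    bit b + 2 * suc q ∎
  where
  open ≡-Reasoning
  q = proj₁ (half x)
  b = proj₂ (half x)

toBits : ℕ → ℕ → List Bool
toBits x zero = []
toBits x (suc l) = proj₂ (half x) ∷ toBits (proj₁ (half x)) l

fromBits : List Bool → ℕ
fromBits [] = 0
fromBits (b ∷ bs) = bit b + 2 * fromBits bs

length-toBits : ∀ x l → length (toBits x l) ≡ l
length-toBits x zero = refl
length-toBits x (suc l) = cong suc (length-toBits _ l)

half-< : ∀ x y → x < 2 * y → proj₁ (half x) < y
half-< x y lt = *-cancelˡ-< 2 _ _ (≤-<-trans (m≤n+m (2 * proj₁ (half x)) (bit (proj₂ (half x))))
                   (subst (_< 2 * y) (half-spec x) lt))

fromBits-toBits : ∀ l x → x < 2 ^ l → fromBits (toBits x l) ≡ x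
fromBits-toBits zero x lt = ≡sym (n≤0⇒n≡0 (≤-pred lt))
fromBits-toBits (suc l) x lt = trans (cong (λ z → bit (proj₂ (half x)) + 2 * z) (fromBits-toBits l _ (half-< x (2 ^ l) lt))) (≡sym (half-spec x))

take-length-++ : ∀ {A : Set} (xs ys : List A) l → length xs ≡ l → take l (xs ++ ys) ≡ xs
take-length-++ [] ys zero e = refl
take-length-++ (x ∷ xs) ys (suc l) e = cong (x ∷_) (take-length-++ xs ys l (cong pred e))

drop-length-++ : ∀ {A : Set} (xs ys : List A) l → length xs ≡ l → drop l (xs ++ ys) ≡ ys
drop-length-++ [] ys zero e = refl
drop-length-++ (x ∷ xs) ys (suc l) e = drop-length-++ xs ys l (cong pred e)

range : ℕ → ℕ → List ℕ
range a zero = []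
range a (suc l) = a ∷ range (suc a) l

range-++ : ∀ a l1 l2 → range a (l1 + l2) ≡ range a l1 ++ range (a + l1) l2
range-++ a zero l2 = cong (λ z → range z l2) (≡sym (+-identityʳ a))
range-++ a (suc l1) l2 = cong (a ∷_) (trans (range-++ (suc a) l1 l2) (cong (λ z → range (suc a) l1 ++ range z l2) (≡sym (+-suc a l1))))

lookupOrFalse : List Bool → ℕ → Bool
lookupOrFalse [] i = false
lookupOrFalse (x ∷ xs) zero = x
lookupOrFalse (x ∷ xs) (suc i) = lookupOrFalse xs i

map-range-suc : ∀ (f : ℕ → Bool) a l → map f (range (suc a) l) ≡ map (λ i → f (suc i)) (range a l)
map-range-suc f a zero = refl
map-range-suc f a (suc l) = cong (f (suc a) ∷_) (map-range-suc f (suc a) l)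

map-lookupOrFalse : ∀ xs N → length xs ≤ N → map (lookupOrFalse xs) (range 0 N) ≡ xs ++ List.replicate (N ∸ length xs) false
map-lookupOrFalse [] zero le = refl
map-lookupOrFalse [] (suc N) le = cong (false ∷_) (trans (map-range-suc (lookupOrFalse []) 0 N) (map-lookupOrFalse [] N z≤n))
map-lookupOrFalse (x ∷ xs) (suc N) (s≤s le) = cong (x ∷_) (trans (map-range-suc (lookupOrFalse (x ∷ xs)) 0 N) (map-lookupOrFalse xs N le))

-- A packet starts with a 1, so silence (all-zero chunks) is never mistaken for a packet.
module Codec (n L Lh B : ℕ) where
  Packet : Set
  Packet = Fin n × Fin n × ℕ

  packetBits : Maybe Packet → List Bool
  packetBits nothing = []
  packetBits (just (a , b , h)) = true ∷ (toBits (toℕ a) L ++ (toBits (toℕ b) L ++ toBits h Lh))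

  bitAt : Maybe Packet → ℕ → Bool
  bitAt P = lookupOrFalse (packetBits P)

  readBits : (ℕ → Bool) → ℕ → (l : ℕ) → Vec Bool l
  readBits s a zero = []
  readBits s a (suc l) = s a ∷ readBits s (suc a) l

  chunk : Maybe Packet → ℕ → Vec Bool B
  chunk P p = readBits (bitAt P) (p * B) B

  chunksUpTo : Maybe Packet → ℕ → List (Vec Bool B)
  chunksUpTo P zero = []
  chunksUpTo P (suc j) = chunk P j ∷ chunksUpTo P j

  toFin : ℕ → Maybe (Fin n)
  toFin x with x <? n
  ... | yes p = just (fromℕ< p)
  ... | no _ = nothing

  toFin-ok : ∀ a → toFin (toℕ a) ≡ just a
  toFin-ok a with toℕ a <? n
  ... | yes p = cong just (fromℕ<-toℕ a p)
  ... | no np = ⊥-elim (np (toℕ<n a))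

  combine : Maybe (Fin n) → Maybe (Fin n) → ℕ → Maybe Packet
  combine (just a) (just b) h = just (a , b , h)
  combine _ _ h = nothing

  parse : List Bool → Maybe Packet
  parse [] = nothing
  parse (false ∷ _) = nothing
  parse (true ∷ bs) = combine (toFin (fromBits (take L bs))) (toFin (fromBits (take L (drop L bs))))
                           (fromBits (take Lh (drop L (drop L bs))))

  concatChunks : List (Vec Bool B) → List Bool
  concatChunks [] = []
  concatChunks (c ∷ cs) = concatChunks cs ++ toList c

  decode : List (Vec Bool B) → Maybe Packet
  decode cs = parse (concatChunks cs)

  readBits-toList : ∀ s a l → toList (readBits s a l) ≡ map s (range a l)
  readBits-toList s a zero = refl
  readBits-toList s a (suc l) = cong (s a ∷_) (readBits-toList s (suc a) l)

  concat-chunksUpTo : ∀ P j → concatChunks (chunksUpTo P j) ≡ map (bitAt P) (range 0 (j * B))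
  concat-chunksUpTo P zero = refl
  concat-chunksUpTo P (suc j) = begin
      concatChunks (chunksUpTo P j) ++ toList (chunk P j)
        ≡⟨ cong₂ _++_ (concat-chunksUpTo P j) (readBits-toList (bitAt P) (j * B) B) ⟩
      map (bitAt P) (range 0 (j * B)) ++ map (bitAt P) (range (j * B) B)
        ≡⟨ ≡sym (map-++ (bitAt P) (range 0 (j * B)) _) ⟩
      map (bitAt P) (range 0 (j * B) ++ range (0 + j * B) B)
        ≡⟨ cong (map (bitAt P)) (≡sym (range-++ 0 (j * B) B)) ⟩
      map (bitAt P) (range 0 (j * B + B))
        ≡⟨ cong (λ z → map (bitAt P) (range 0 z)) (+-comm (j * B) B) ⟩
      map (bitAt P) (range 0 (suc j * B)) ∎
    where open ≡-Reasoning

  parse-zeros : ∀ N → parse (List.replicate N false) ≡ nothing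
  parse-zeros zero = refl
  parse-zeros (suc N) = refl

  parse-packetBits : ∀ a b h zs → n ≤ 2 ^ L → h < 2 ^ Lh → parse (packetBits (just (a , b , h)) ++ zs) ≡ just (a , b , h)
  parse-packetBits a b h zs hn hh = begin
      combine (toFin (fromBits (take L bs))) (toFin (fromBits (take L (drop L bs))))
           (fromBits (take Lh (drop L (drop L bs))))
        ≡⟨ cong₂ (λ u w → combine (toFin (fromBits u)) (toFin (fromBits (take L w))) (fromBits (take Lh (drop L w)))) e1 e2 ⟩
      combine (toFin (fromBits xa)) (toFin (fromBits (take L (xb ++ (xh ++ zs))))) (fromBits (take Lh (drop L (xb ++ (xh ++ zs)))))
        ≡⟨ cong₂ (λ u w → combine (toFin (fromBits xa)) (toFin (fromBits u)) (fromBits (take Lh w))) e3 e4 ⟩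
      combine (toFin (fromBits xa)) (toFin (fromBits xb)) (fromBits (take Lh (xh ++ zs)))
        ≡⟨ cong (λ u → combine (toFin (fromBits xa)) (toFin (fromBits xb)) (fromBits u)) (take-length-++ xh zs Lh (length-toBits h Lh)) ⟩
      combine (toFin (fromBits xa)) (toFin (fromBits xb)) (fromBits xh)
        ≡⟨ cong₂ (λ u w → combine (toFin u) (toFin w) (fromBits xh)) (fromBits-toBits L (toℕ a) (<-≤-trans (toℕ<n a) hn)) (fromBits-toBits L (toℕ b) (<-≤-trans (toℕ<n b) hn)) ⟩
      combine (toFin (toℕ a)) (toFin (toℕ b)) (fromBits xh)
        ≡⟨ cong₂ (λ u w → combine u w (fromBits xh)) (toFin-ok a) (toFin-ok b) ⟩
      just (a , b , fromBits xh)
        ≡⟨ cong (λ z → just (a , b , z)) (fromBits-toBits Lh h hh) ⟩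
      just (a , b , h) ∎
    where
    open ≡-Reasoning
    xa = toBits (toℕ a) L
    xb = toBits (toℕ b) L
    xh = toBits h Lh
    bs = (xa ++ (xb ++ xh)) ++ zs
    bs≡ : bs ≡ xa ++ (xb ++ (xh ++ zs))
    bs≡ = trans (++-assoc xa (xb ++ xh) zs) (cong (xa ++_) (++-assoc xb xh zs))
    e1 : take L bs ≡ xa
    e1 = trans (cong (take L) bs≡) (take-length-++ xa _ L (length-toBits _ L))
    e2 : drop L bs ≡ xb ++ (xh ++ zs)
    e2 = trans (cong (drop L) bs≡) (drop-length-++ xa _ L (length-toBits _ L))
    e3 : take L (xb ++ (xh ++ zs)) ≡ xb
    e3 = take-length-++ xb _ L (length-toBits _ L)
    e4 : drop L (xb ++ (xh ++ zs)) ≡ xh ++ zs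
    e4 = drop-length-++ xb _ L (length-toBits _ L)

  length-packetBits : ∀ a b h → length (packetBits (just (a , b , h))) ≡ suc (L + (L + Lh))
  length-packetBits a b h = cong suc (trans (length-++ (toBits (toℕ a) L))
     (cong₂ _+_ (length-toBits _ L) (trans (length-++ (toBits (toℕ b) L)) (cong₂ _+_ (length-toBits _ L) (length-toBits h Lh)))))

  decode-chunksUpTo : ∀ m → n ≤ 2 ^ L → suc (L + (L + Lh)) ≤ m * B → ∀ a b h → h < 2 ^ Lh →
    decode (chunksUpTo (just (a , b , h)) m) ≡ just (a , b , h)
  decode-chunksUpTo m hn hb a b h hh = begin
      parse (concatChunks (chunksUpTo P m)) ≡⟨ cong parse (concat-chunksUpTo P m) ⟩
      parse (map (bitAt P) (range 0 (m * B))) ≡⟨ cong parse (map-lookupOrFalse (packetBits P) (m * B) (subst (_≤ m * B) (≡sym (length-packetBits a b h)) hb)) ⟩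
      parse (packetBits P ++ _) ≡⟨ parse-packetBits a b h _ hn hh ⟩
      just (a , b , h) ∎
    where
    open ≡-Reasoning
    P = just (a , b , h)

  decode-silence : ∀ j → decode (chunksUpTo nothing j) ≡ nothing
  decode-silence j = trans (cong parse (trans (concat-chunksUpTo nothing j) (map-lookupOrFalse [] (j * B) z≤n))) (parse-zeros (j * B))

  readBits-nothing : ∀ a l → readBits (bitAt nothing) a l ≡ replicate l false
  readBits-nothing a zero = refl
  readBits-nothing a (suc l) = cong (false ∷_) (readBits-nothing (suc a) l)

  chunk-nothing : ∀ p → chunk nothing p ≡ replicate B false
  chunk-nothing p = readBits-nothing (p * B) B



sameEdge : ∀ {n} → Fin n × Fin n → Fin n → Fin n → Bool
sameEdge (a , b) c d = (eqB a c ∧ eqB b d) ∨ (eqB a d ∧ eqB b c)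

sameEdge-sym : ∀ {n} (e : Fin n × Fin n) c d → sameEdge e c d ≡ sameEdge e d c
sameEdge-sym (a , b) c d = ∨-comm (eqB a c ∧ eqB b d) (eqB a d ∧ eqB b c)

sameEdge-swap : ∀ {n} (a b : Fin n) c d → sameEdge (b , a) c d ≡ sameEdge (a , b) c d
sameEdge-swap a b c d = trans (cong₂ _∨_ (∧-comm (eqB b c) (eqB a d)) (∧-comm (eqB b d) (eqB a c)))
                        (∨-comm (eqB a d ∧ eqB b c) (eqB a c ∧ eqB b d))

listed : ∀ {n} → List (Fin n × Fin n) → Fin n → Fin n → Bool
listed [] c d = false
listed (e ∷ D) c d = sameEdge e c d ∨ listed D c d

listed-sym : ∀ {n} (D : List (Fin n × Fin n)) c d → listed D c d ≡ listed D d c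
listed-sym [] c d = refl
listed-sym (e ∷ D) c d = cong₂ _∨_ (sameEdge-sym e c d) (listed-sym D c d)

deleteEdges : ∀ {n} → Graph n → List (Fin n × Fin n) → Graph n
deleteEdges G D = record { adj = λ c d → adj G c d ∧ not (listed D c d)
                ; sym = λ c d → cong₂ (λ u w → u ∧ not w) (sym G c d) (listed-sym D c d)
                ; irrefl = λ c → cong (_∧ not (listed D c c)) (irrefl G c) }

-- Both endpoints of a deleted edge announce it; ordering the pair by ID makes their packets
-- identical, so the superimposed transmissions still decode.
orient : ∀ {n} → Fin n → Fin n → Fin n × Fin n
orient a b = if toℕ a ≤ᵇ toℕ b then (a , b) else (b , a)

orient-sym : ∀ {n} (a b : Fin n) → a ≢ b → orient a b ≡ orient b a
orient-sym a b ne with toℕ a ≤ᵇ toℕ b in e1 | toℕ b ≤ᵇ toℕ a in e2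
... | true | true = ⊥-elim (ne (toℕ-injective (≤-antisym (≤ᵇ⇒≤ _ _ (subst T (≡sym e1) tt)) (≤ᵇ⇒≤ _ _ (subst T (≡sym e2) tt)))))
... | true | false = refl
... | false | true = refl
... | false | false = ⊥-elim (≤ᵇ-total (toℕ a) (toℕ b) e1 e2)
  where
  ≤ᵇ-total : ∀ p q → (p ≤ᵇ q) ≡ false → (q ≤ᵇ p) ≡ false → ⊥
  ≤ᵇ-total p q e1 e2 with ≤-total p q
  ... | inj₁ le = subst T e1 (≤⇒≤ᵇ le)
  ... | inj₂ le = subst T e2 (≤⇒≤ᵇ le)

sameEdge-orient : ∀ {n} (a b : Fin n) c d → sameEdge (orient a b) c d ≡ sameEdge (a , b) c d
sameEdge-orient a b c d with toℕ a ≤ᵇ toℕ b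
... | true = refl
... | false = sameEdge-swap a b c d

isZero : ℕ → Bool
isZero zero = true
isZero (suc _) = false

orBits : ∀ {l} → Vec Bool l → Vec Bool l → Vec Bool l
orBits [] [] = []
orBits (x ∷ xs) (y ∷ ys) = (x ∨ y) ∷ orBits xs ys

orBits-zeroˡ : ∀ {l} (v : Vec Bool l) → orBits (replicate l false) v ≡ v
orBits-zeroˡ [] = refl
orBits-zeroˡ (x ∷ v) = cong (x ∷_) (orBits-zeroˡ v)

orBits-zeroʳ : ∀ {l} (v : Vec Bool l) → orBits v (replicate l false) ≡ v
orBits-zeroʳ [] = refl
orBits-zeroʳ (x ∷ v) = cong₂ _∷_ (∨-identityʳ x) (orBits-zeroʳ v)

orBits-idem : ∀ {l} (v : Vec Bool l) → orBits v v ≡ v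
orBits-idem [] = refl
orBits-idem (x ∷ v) = cong₂ _∷_ (∨-idem x) (orBits-idem v)


sameEdge⇒endpoint : ∀ {n} (x y c d : Fin n) → sameEdge (x , y) c d ≡ true → (eqB x c ∨ eqB y c) ≡ true
sameEdge⇒endpoint x y c d p with ∨-elim {eqB x c ∧ eqB y d} p
... | inj₁ q = ∨-introˡ _ (proj₁ (∧-elim {eqB x c} q))
... | inj₂ q = ∨-introʳ (eqB x c) (proj₂ (∧-elim {eqB x d} q))

not-∨-elim : ∀ a b → not (a ∨ b) ≡ true → not a ≡ true × not b ≡ true
not-∨-elim false false _ = refl , refl

unlisted⇒false : ∀ l p o → p ≡ true → not ((l ∧ p) ∨ o) ≡ true → l ≡ false
unlisted⇒false false p o _ _ = refl
unlisted⇒false true true o _ ()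

sameEdge-refl : ∀ {n} (x y : Fin n) → sameEdge (x , y) x y ≡ true
sameEdge-refl x y rewrite eqB-refl x | eqB-refl y = refl

deletion-adj : ∀ {n} (G0 G1 : Graph n) x y → (∀ i j → (adj G1 i j ≡ true) ⇔ (adj G0 i j ≡ true × ¬ ((i ≡ x × j ≡ y) ⊎ (i ≡ y × j ≡ x)))) →
  ∀ c d → adj G1 c d ≡ adj G0 c d ∧ not (sameEdge (x , y) c d)
deletion-adj G0 G1 x y sp c d with adj G1 c d in e1
... | true = true≡∧not (proj₁ (Equivalence.to (sp c d) e1)) (λ ep → proj₂ (Equivalence.to (sp c d) e1) (sameEdge⇒endpoints ep))
  where
  true≡∧not : ∀ {g p} → g ≡ true → (p ≡ true → ⊥) → true ≡ g ∧ not p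
  true≡∧not {true} {false} _ _ = refl
  true≡∧not {true} {true} _ np = ⊥-elim (np refl)
  sameEdge⇒endpoints : sameEdge (x , y) c d ≡ true → (c ≡ x × d ≡ y) ⊎ (c ≡ y × d ≡ x)
  sameEdge⇒endpoints q with ∨-elim {eqB x c ∧ eqB y d} q
  ... | inj₁ q' = inj₁ (≡sym (eqB-true (proj₁ (∧-elim {eqB x c} q'))) , ≡sym (eqB-true (proj₂ (∧-elim {eqB x c} q'))))
  ... | inj₂ q' = inj₂ (≡sym (eqB-true (proj₂ (∧-elim {eqB x d} q'))) , ≡sym (eqB-true (proj₁ (∧-elim {eqB x d} q'))))
... | false = false≡∧not (λ g0 np → t≢f (Equivalence.from (sp c d) (g0 , ¬sameEdge⇒¬endpoints np)) e1)
  where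
  false≡∧not : ∀ {g p} → (g ≡ true → (p ≡ true → ⊥) → ⊥) → false ≡ g ∧ not p
  false≡∧not {true} {false} k = ⊥-elim (k refl (λ ()))
  false≡∧not {true} {true} k = refl
  false≡∧not {false} k = refl
  ¬sameEdge⇒¬endpoints : (sameEdge (x , y) c d ≡ true → ⊥) → ¬ ((c ≡ x × d ≡ y) ⊎ (c ≡ y × d ≡ x))
  ¬sameEdge⇒¬endpoints np (inj₁ (refl , refl)) = np (cong (λ z → z ∨ (eqB c d ∧ eqB d c)) (cong₂ _∧_ (eqB-refl c) (eqB-refl d)))
  ¬sameEdge⇒¬endpoints np (inj₂ (refl , refl)) = np (trans (cong (λ z → (eqB d c ∧ eqB c d) ∨ z) (cong₂ _∧_ (eqB-refl d) (eqB-refl c))) (∨-zeroʳ _))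

deletion-changes : ∀ {n} (G0 G1 : Graph n) x y → adj G0 x y ≡ true → (∀ c d → adj G1 c d ≡ adj G0 c d ∧ not (sameEdge (x , y) c d)) → ¬ (G1 ≈G G0)
deletion-changes G0 G1 x y xy dl eq = t≢f (trans (eq x y) xy) (trans (dl x y) (cong₂ (λ u v → u ∧ not v) xy (sameEdge-refl x y)))

module Protocol {k} (H : Graph k) (n L Lh B m' R' : ℕ) where
  open Codec n L Lh B public

  m : ℕ
  m = suc m'
  R : ℕ
  R = suc R'

  -- nb: last seen neighbours; ph: round within the current phase; D: known deletions;
  -- pend: packet to send in the next phase; out: packet being sent; buf: chunks received this phase.
  record NodeState : Set where
    constructor st
    field
      me : Fin n
      g0 : Graph n
      nb : Fin n → Bool
      ph : ℕ
      D : List (Fin n × Fin n)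
      pend : Maybe Packet
      out : Maybe Packet
      buf : List (Vec Bool B)
  open NodeState public

  lost : (Fin n → Bool) → (Fin n → Bool) → Fin n → Bool
  lost old new y = old y ∧ not (new y)

  detect : NodeState → (Fin n → Bool) → Maybe (Fin n)
  detect s nbNow with any? (λ y → lost (nb s) nbNow y ≟B true)
  ... | yes (y , _) = just y
  ... | no _ = nothing

  withHops : Fin n × Fin n → ℕ → Packet
  withHops (a , b) h = a , b , h

  newPacket : NodeState → (Fin n → Bool) → Maybe Packet
  newPacket s nbNow with detect s nbNow
  ... | just y = just (withHops (orient (me s) y) 1)
  ... | nothing = nothing

  outgoing : NodeState → (Fin n → Bool) → Maybe Packet
  outgoing s nbNow = if isZero (ph s) then (newPacket s nbNow <∣> pend s) else out s

  sendF : NodeState → (Fin n → Bool) → Fin n → Vec Bool B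
  sendF s nbNow u = chunk (outgoing s nbNow) (ph s)

  orM : Maybe (Vec Bool B) → Vec Bool B → Vec Bool B
  orM nothing acc = acc
  orM (just c) acc = orBits c acc

  orMsgs : (Fin n → Maybe (Vec Bool B)) → Vec Bool B
  orMsgs msgs = foldr (λ u acc → orM (msgs u) acc) (replicate B false) (allFin n)

  addDetected : Fin n → Maybe (Fin n) → List (Fin n × Fin n) → List (Fin n × Fin n)
  addDetected v (just y) D = (v , y) ∷ D
  addDetected v nothing D = D

  addLearned : Maybe Packet → List (Fin n × Fin n) → List (Fin n × Fin n)
  addLearned (just (a , b , h)) D = (a , b) ∷ D
  addLearned nothing D = D

  forward : Maybe Packet → Maybe Packet
  forward (just (a , b , h)) = if h <ᵇ R then just (a , b , suc h) else nothing
  forward nothing = nothing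

  stepMid : NodeState → (Fin n → Bool) → (Fin n → Maybe (Vec Bool B)) → NodeState
  stepMid s nbNow msgs = record s
    { nb = nbNow ; ph = suc (ph s) ; D = addDetected (me s) (detect s nbNow) (D s)
    ; pend = if isZero (ph s) then nothing else (newPacket s nbNow <∣> pend s)
    ; out = outgoing s nbNow ; buf = orMsgs msgs ∷ buf s }

  stepEnd : NodeState → (Fin n → Bool) → (Fin n → Maybe (Vec Bool B)) → NodeState
  stepEnd s nbNow msgs = record s
    { nb = nbNow ; ph = 0
    ; D = addLearned (decode (orMsgs msgs ∷ buf s)) (addDetected (me s) (detect s nbNow) (D s))
    ; pend = (if isZero (ph s) then nothing else (newPacket s nbNow <∣> pend s)) <∣> forward (decode (orMsgs msgs ∷ buf s))
    ; out = outgoing s nbNow ; buf = [] }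

  stepF : NodeState → (Fin n → Bool) → (Fin n → Maybe (Vec Bool B)) → NodeState
  stepF s nbNow msgs = if suc (ph s) ≡ᵇ m then stepEnd s nbNow msgs else stepMid s nbNow msgs

  initF : Fin n → Graph n → NodeState
  initF v G = st v G (adj G v) 0 [] nothing nothing []

  outF : NodeState → Graph n → Bool
  outF s F = does (memListCopy? H (deleteEdges (g0 s) (D s)) (me s) F)

  algorithm : Algorithm n B
  algorithm = record { State = NodeState ; init = initF ; send = sendF ; step = stepF ; out = outF }

  detect-none : ∀ s nbNow → (∀ y → nb s y ≡ nbNow y) → detect s nbNow ≡ nothing
  detect-none s nbNow e with any? (λ y → lost (nb s) nbNow y ≟B true)
  ... | no _ = refl
  ... | yes (y , p) = ⊥-elim (t≢f p (∧-not-≡ (e y)))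

  detect-one : ∀ s nbNow y0 → (∀ y → y ≢ y0 → nb s y ≡ nbNow y) → nb s y0 ≡ true → nbNow y0 ≡ false →
    detect s nbNow ≡ just y0
  detect-one s nbNow y0 e p q with any? (λ y → lost (nb s) nbNow y ≟B true)
  ... | no np = ⊥-elim (np (y0 , subst (λ z → z ∧ not (nbNow y0) ≡ true) (≡sym p) (cong not q)))
  ... | yes (y , r) with y ≟F y0
  ... | yes refl = refl
  ... | no ne = ⊥-elim (t≢f r (∧-not-≡ (e y ne)))

  newPacket-none : ∀ s nbNow → detect s nbNow ≡ nothing → newPacket s nbNow ≡ nothing
  newPacket-none s nbNow e with detect s nbNow
  ... | nothing = refl

  newPacket-one : ∀ s nbNow y → detect s nbNow ≡ just y → newPacket s nbNow ≡ just (withHops (orient (me s) y) 1)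
  newPacket-one s nbNow y e with detect s nbNow | e
  ... | just .y | refl = refl

  stepF-mid : ∀ s nbNow msgs → (suc (ph s) ≡ᵇ m) ≡ false → stepF s nbNow msgs ≡ stepMid s nbNow msgs
  stepF-mid s nbNow msgs e rewrite e = refl

  stepF-end : ∀ s nbNow msgs → (suc (ph s) ≡ᵇ m) ≡ true → stepF s nbNow msgs ≡ stepEnd s nbNow msgs
  stepF-end s nbNow msgs e rewrite e = refl

  chunkIf : Bool → Packet → ℕ → Vec Bool B
  chunkIf b pk φ = if b then chunk (just pk) φ else replicate B false

  orMsgs-foldr : ∀ (msgs : Fin n → Maybe (Vec Bool B)) (g : Fin n → Bool) (c : Vec Bool B) →
    (∀ u → (msgs u ≡ nothing × g u ≡ false) ⊎ (msgs u ≡ just (replicate B false) × g u ≡ false) ⊎ (msgs u ≡ just c × g u ≡ true)) →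
    ∀ xs → foldr (λ u acc → orM (msgs u) acc) (replicate B false) xs ≡ (if anyL g xs then c else replicate B false)
  orMsgs-foldr msgs g c h [] = refl
  orMsgs-foldr msgs g c h (x ∷ xs) with h x | orMsgs-foldr msgs g c h xs
  ... | inj₁ (e1 , e2) | ih rewrite e1 | e2 = ih
  ... | inj₂ (inj₁ (e1 , e2)) | ih rewrite e1 | e2 = trans (orBits-zeroˡ _) ih
  ... | inj₂ (inj₂ (e1 , e2)) | ih rewrite e1 | e2 | ih with anyL g xs
  ... | true = orBits-idem c
  ... | false = orBits-zeroʳ c

  chunkIf-ok : ∀ b pk φ → chunk (if b then just pk else nothing) φ ≡ chunkIf b pk φ
  chunkIf-ok true pk φ = refl
  chunkIf-ok false pk φ = chunk-nothing φ

  reception : ∀ (A : Fin n → Fin n → Bool) (sends : Fin n → Bool) (pk : Packet) (φ : ℕ)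
    (sf : Fin n → Vec Bool B) → (∀ u → sf u ≡ chunk (if sends u then just pk else nothing) φ) → ∀ v →
    orMsgs (λ u → if A v u then just (sf u) else nothing) ≡
      chunk (if any (λ u → A v u ∧ sends u) then just pk else nothing) φ
  reception A sends pk φ sf hs v = trans (orMsgs-foldr _ (λ u → A v u ∧ sends u) (chunk (just pk) φ) cases (allFin n))
     (≡sym (chunkIf-ok (any (λ u → A v u ∧ sends u)) pk φ))
    where
    msgs : Fin n → Maybe (Vec Bool B)
    msgs u = if A v u then just (sf u) else nothing
    cases : ∀ u → (msgs u ≡ nothing × (A v u ∧ sends u) ≡ false) ⊎ (msgs u ≡ just (replicate B false) × (A v u ∧ sends u) ≡ false) ⊎ (msgs u ≡ just (chunk (just pk) φ) × (A v u ∧ sends u) ≡ true)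
    cases u with A v u | sends u | hs u
    ... | false | _ | _ = inj₁ (refl , refl)
    ... | true | false | e = inj₂ (inj₁ (cong just (trans e (chunk-nothing φ)) , refl))
    ... | true | true | e = inj₂ (inj₂ (cong just e , refl))


module RoundStep {k} (H : Graph k) (n L Lh B m' R' : ℕ) where
  open Protocol H n L Lh B m' R' public

  record StateIs (s : NodeState) (w : Fin n) (G0 Gc : Graph n) (φ : ℕ) (pendV outV bufP : Maybe Packet)
             (Dsem : Fin n → Fin n → Bool) : Set where
    field
      me≡ : me s ≡ w
      g0≡ : g0 s ≡ G0
      nb≡ : ∀ u → nb s u ≡ adj Gc w u
      ph≡ : ph s ≡ φ
      pend≡ : pend s ≡ pendV
      out≡ : isZero φ ≡ false → out s ≡ outV
      buf≡ : buf s ≡ chunksUpTo bufP φ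
      D≡ : ∀ c d → listed (D s) c d ≡ Dsem c d

  nextS : Graph n → (Fin n → NodeState) → Fin n → NodeState
  nextS G' c w = stepF (c w) (adj G' w) (λ u → if adj G' w u then just (sendF (c u) (adj G' u) w) else nothing)

  detected : Maybe (Fin n) → Fin n → Fin n → Fin n → Bool
  detected (just y) w c d = sameEdge (w , y) c d
  detected nothing w c d = false

  learnt : Maybe Packet → Fin n → Fin n → Bool
  learnt (just (a , b , h)) c d = sameEdge (a , b) c d
  learnt nothing c d = false

  listed-addDetected : ∀ w dt Dl c d → listed (addDetected w dt Dl) c d ≡ detected dt w c d ∨ listed Dl c d
  listed-addDetected w (just y) Dl c d = refl
  listed-addDetected w nothing Dl c d = refl

  listed-addLearned : ∀ P Dl c d → listed (addLearned P Dl) c d ≡ learnt P c d ∨ listed Dl c d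
  listed-addLearned (just (a , b , h)) Dl c d = refl
  listed-addLearned nothing Dl c d = refl

  chunksUpTo-suc : ∀ φ P Q → (isZero φ ≡ false → Q ≡ P) → chunk P φ ∷ chunksUpTo Q φ ≡ chunksUpTo P (suc φ)
  chunksUpTo-suc zero P Q h = refl
  chunksUpTo-suc (suc φ) P Q h = cong (chunk P (suc φ) ∷_) (cong (λ z → chunksUpTo z (suc φ)) (h refl))

  module _ (c : Fin n → NodeState) (G0 Gc G' : Graph n) (φ : ℕ)
           (pendV outV bufP : Fin n → Maybe Packet) (Dsem : Fin n → Fin n → Fin n → Bool)
           (nok : ∀ w → StateIs (c w) w G0 Gc φ (pendV w) (outV w) (bufP w) (Dsem w))
           (det : Fin n → Maybe (Fin n)) (det≡ : ∀ w → detect (c w) (adj G' w) ≡ det w)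
           (pk : Packet) (sends : Fin n → Bool) where
    -- During one phase the only packet in the network is pk, sent by the nodes satisfying sends.

    np : Fin n → Maybe Packet
    np w = newPacket (c w) (adj G' w)

    sent : Fin n → Maybe Packet
    sent w = if isZero φ then (np w <∣> pendV w) else outV w

    outgoing≡ : ∀ w → outgoing (c w) (adj G' w) ≡ sent w
    outgoing≡ w with isZero φ in e
    ... | true rewrite StateIs.ph≡ (nok w) | e | StateIs.pend≡ (nok w) = refl
    ... | false rewrite StateIs.ph≡ (nok w) | e = StateIs.out≡ (nok w) e

    recvP : Fin n → Maybe Packet
    recvP w = if any (λ u → adj G' w u ∧ sends u) then just pk else nothing

    module _ (sent≡ : ∀ u → sent u ≡ (if sends u then just pk else nothing))
             (bufOK : ∀ w → isZero φ ≡ false → bufP w ≡ recvP w) where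

      rec≡ : ∀ w → orMsgs (λ u → if adj G' w u then just (sendF (c u) (adj G' u) w) else nothing) ≡ chunk (recvP w) φ
      rec≡ w = reception (adj G') sends pk φ (λ u → sendF (c u) (adj G' u) w)
                 (λ u → trans (cong₂ chunk (trans (outgoing≡ u) (sent≡ u)) (StateIs.ph≡ (nok u))) refl) w

      bufNew : ∀ w → chunk (recvP w) φ ∷ chunksUpTo (bufP w) φ ≡ chunksUpTo (recvP w) (suc φ)
      bufNew w = chunksUpTo-suc φ (recvP w) (bufP w) (bufOK w)

      round-mid : (suc φ ≡ᵇ m) ≡ false → ∀ w →
        StateIs (nextS G' c w) w G0 G' (suc φ)
            (if isZero φ then nothing else (np w <∣> pendV w)) (sent w) (recvP w)
            (λ a b → detected (det w) w a b ∨ Dsem w a b)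
      round-mid e w rewrite stepF-mid (c w) (adj G' w) (λ u → if adj G' w u then just (sendF (c u) (adj G' u) w) else nothing)
                              (trans (cong (λ z → suc z ≡ᵇ m) (StateIs.ph≡ (nok w))) e) = record
        { me≡ = StateIs.me≡ (nok w)
        ; g0≡ = StateIs.g0≡ (nok w)
        ; nb≡ = λ u → refl
        ; ph≡ = cong suc (StateIs.ph≡ (nok w))
        ; pend≡ = subst (λ z → (if isZero z then nothing else (np w <∣> pend (c w))) ≡ (if isZero φ then nothing else (np w <∣> pendV w)))
                    (≡sym (StateIs.ph≡ (nok w))) (cong (λ z → if isZero φ then nothing else (np w <∣> z)) (StateIs.pend≡ (nok w)))
        ; out≡ = λ _ → outgoing≡ w
        ; buf≡ = trans (cong₂ _∷_ (rec≡ w) (StateIs.buf≡ (nok w))) (bufNew w)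
        ; D≡ = λ a b → trans (listed-addDetected (me (c w)) (detect (c w) (adj G' w)) (D (c w)) a b)
                 (cong₂ _∨_ (cong₂ (λ u z → detected z u a b) (StateIs.me≡ (nok w)) (det≡ w)) (StateIs.D≡ (nok w) a b))
        }

      module _ (decOK : (∃ λ u → sends u ≡ true) → decode (chunksUpTo (just pk) m) ≡ just pk) where
        decRecv : ∀ w → (suc φ ≡ m) → decode (chunk (recvP w) φ ∷ chunksUpTo (bufP w) φ) ≡ recvP w
        decAt : ∀ b → (b ≡ true → ∃ λ u → sends u ≡ true) → decode (chunksUpTo (if b then just pk else nothing) m) ≡ (if b then just pk else nothing)
        decAt true h = decOK (h refl)
        decAt false h = decode-silence m

        decRecv w e = trans (cong decode (trans (bufNew w) (cong (chunksUpTo (recvP w)) e)))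
                        (decAt _ (λ eq → let (u , q) = any-true _ eq in u , proj₂ (∧-elim {adj G' w u} q)))

        round-end : (suc φ ≡ᵇ m) ≡ true → (suc φ ≡ m) → ∀ w →
          StateIs (nextS G' c w) w G0 G' 0
              ((if isZero φ then nothing else (np w <∣> pendV w)) <∣> forward (recvP w)) (sent w) nothing
              (λ a b → learnt (recvP w) a b ∨ (detected (det w) w a b ∨ Dsem w a b))
        round-end e e' w rewrite stepF-end (c w) (adj G' w) (λ u → if adj G' w u then just (sendF (c u) (adj G' u) w) else nothing)
                              (trans (cong (λ z → suc z ≡ᵇ m) (StateIs.ph≡ (nok w))) e) = record
          { me≡ = StateIs.me≡ (nok w)
          ; g0≡ = StateIs.g0≡ (nok w)
          ; nb≡ = λ u → refl
          ; ph≡ = refl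
          ; pend≡ = cong₂ _<∣>_
                     (subst (λ z → (if isZero z then nothing else (np w <∣> pend (c w))) ≡ (if isZero φ then nothing else (np w <∣> pendV w)))
                       (≡sym (StateIs.ph≡ (nok w))) (cong (λ z → if isZero φ then nothing else (np w <∣> z)) (StateIs.pend≡ (nok w))))
                     (cong forward decEq)
          ; out≡ = λ ()
          ; buf≡ = refl
          ; D≡ = λ a b → trans (listed-addLearned (decode (orMsgs (λ u → if adj G' w u then just (sendF (c u) (adj G' u) w) else nothing) ∷ buf (c w))) (addDetected (me (c w)) (detect (c w) (adj G' w)) (D (c w))) a b)
                   (cong₂ _∨_ (cong (λ z → learnt z a b) decEq)
                     (trans (listed-addDetected (me (c w)) (detect (c w) (adj G' w)) (D (c w)) a b)
                       (cong₂ _∨_ (cong₂ (λ u z → detected z u a b) (StateIs.me≡ (nok w)) (det≡ w)) (StateIs.D≡ (nok w) a b))))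
          }
          where
          decEq : decode (orMsgs (λ u → if adj G' w u then just (sendF (c u) (adj G' u) w) else nothing) ∷ buf (c w)) ≡ recvP w
          decEq = trans (cong₂ (λ x y → decode (x ∷ y)) (rec≡ w) (StateIs.buf≡ (nok w))) (decRecv w e')



∧-∨-collect : ∀ r l P O → (r ∧ P) ∨ ((l ∧ P) ∨ O) ≡ ((l ∨ r) ∧ P) ∨ O
∧-∨-collect true true true O = refl
∧-∨-collect true true false O = refl
∧-∨-collect true false true O = refl
∧-∨-collect true false false O = refl
∧-∨-collect false true P O = refl
∧-∨-collect false false P O = refl

any-∧-const : ∀ {n} (f g : Fin n → Bool) c → any (λ u → f u ∧ (c ∧ g u)) ≡ c ∧ any (λ u → f u ∧ g u)
any-∧-const f g true = refl
any-∧-const f g false = any-false _ (λ u → ∧-zeroʳ (f u))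

does⇔ : ∀ {P : Set} (d : Dec P) → (does d ≡ true) ⇔ P
does⇔ (yes p) = mk⇔ (λ _ → p) (λ _ → refl)
does⇔ (no np) = mk⇔ (λ ()) (λ p → ⊥-elim (np p))

t∸[r∸1]≤i : ∀ t i r → t < i + r → t ∸ (r ∸ 1) ≤ i
t∸[r∸1]≤i t i zero lt = ≤-trans (<⇒≤ lt) (≤-reflexive (+-identityʳ i))
t∸[r∸1]≤i t i (suc r) lt = m≤n+o⇒m∸n≤o t r (≤-trans (≤-pred (≤-trans lt (≤-reflexive (+-suc i r)))) (≤-reflexive (+-comm i r)))

module Execution {k} (H : Graph k) (con : Connected H) (n L Lh B m' R' r : ℕ)
  (R≡ : suc R' ≡ rH H)
  (decOK : ∀ a b h → h ≤ suc R' → Codec.decode n L Lh B (Codec.chunksUpTo n L Lh B (just (a , b , h)) (suc m')) ≡ just (a , b , h))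
  (timing : suc (suc R') * suc m' ≤ suc r)
  (G : DynSeq n) (eds : EdgeDeletionSeq G) (prom : Promise r G) where
  open RoundStep H n L Lh B m' R' public

  cfg : ℕ → Fin n → NodeState
  cfg t = run algorithm G t

  known : (Fin n → Fin n → Bool) → Fin n → Fin n → Bool
  known Dw a b = adj (G 0) a b ∧ not (Dw a b)

  Consistent : Graph n → (Fin n → Fin n → Fin n → Bool) → Set
  Consistent Gt Ds = ∀ w → (∀ a b → adj Gt a b ≡ true → known (Ds w) a b ≡ true) × StaleFree R Gt (known (Ds w)) w

  Consistent-cong : ∀ Gt Gt' Ds → Gt ≈G Gt' → Consistent Gt Ds → Consistent Gt' Ds
  Consistent-cong Gt Gt' Ds e g w = (λ a b q → proj₁ (g w) a b (trans (e a b) q)) ,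
                               (λ a b q q' → proj₂ (g w) a b q (trans (e a b) q'))

  StateIs-cong : ∀ {s w G0 Gc Gc' φ p p' o o' b b' Ds Ds'} → StateIs s w G0 Gc φ p o b Ds →
    (∀ u → adj Gc w u ≡ adj Gc' w u) → p ≡ p' → (isZero φ ≡ false → o ≡ o') → (isZero φ ≡ false → b ≡ b') →
    (∀ a c → Ds a c ≡ Ds' a c) → StateIs s w G0 Gc' φ p' o' b' Ds'
  StateIs-cong {φ = φ} nk eg ep eo eb ed = record
    { me≡ = StateIs.me≡ nk ; g0≡ = StateIs.g0≡ nk
    ; nb≡ = λ u → trans (StateIs.nb≡ nk u) (eg u)
    ; ph≡ = StateIs.ph≡ nk
    ; pend≡ = trans (StateIs.pend≡ nk) ep
    ; out≡ = λ z → trans (StateIs.out≡ nk z) (eo z)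
    ; buf≡ = trans (StateIs.buf≡ nk) (bl φ eb)
    ; D≡ = λ a c → trans (StateIs.D≡ nk a c) (ed a c) }
    where
    bl : ∀ φ {b b'} → (isZero φ ≡ false → b ≡ b') → chunksUpTo b φ ≡ chunksUpTo b' φ
    bl zero h = refl
    bl (suc φ) h = cong (λ z → chunksUpTo z (suc φ)) (h refl)

  phase-advance : ∀ φ → φ < m → ((suc φ ≡ᵇ m) ≡ true × suc φ ≡ m) ⊎ ((suc φ ≡ᵇ m) ≡ false × suc φ < m)
  phase-advance φ lt with suc φ ≡ᵇ m in e
  ... | true = inj₁ (refl , ≡ᵇ⇒≡ (suc φ) m (subst T (≡sym e) tt))
  ... | false = inj₂ (refl , ≤∧≢⇒< lt (λ q → subst T e (≡⇒≡ᵇ (suc φ) m q)))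

  Quiet : ℕ → Set
  Quiet t = Σ ℕ λ φ → Σ (Fin n → Fin n → Fin n → Bool) λ Ds → φ < m ×
    (∀ w → StateIs (cfg t w) w (G 0) (G t) φ nothing nothing nothing (Ds w)) × Consistent (G t) Ds

  quiet-init : Quiet 0
  quiet-init = 0 , (λ _ _ _ → false) , s≤s z≤n ,
    (λ w → record { me≡ = refl ; g0≡ = refl ; nb≡ = λ u → refl ; ph≡ = refl ; pend≡ = refl
                  ; out≡ = λ () ; buf≡ = refl ; D≡ = λ a b → refl }) ,
    (λ w → (λ a b q → trans (∧-identityʳ _) q) , (λ a b q q' → ⊥-elim (t≢f (trans (≡sym (∧-identityʳ _)) q) q')))

  no-detection : ∀ t → G (suc t) ≈G G t → ∀ (Gc : Graph n) → G t ≈G Gc → ∀ φ (p o b : Fin n → Maybe Packet) (Ds : Fin n → Fin n → Fin n → Bool) →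
    (∀ w → StateIs (cfg t w) w (G 0) Gc φ (p w) (o w) (b w) (Ds w)) →
    ∀ w → detect (cfg t w) (adj (G (suc t)) w) ≡ nothing
  no-detection t e Gc e' φ p o b Ds nk w = detect-none _ _ (λ y → trans (StateIs.nb≡ (nk w) y) (≡sym (trans (e w y) (e' w y))))

  nobody-receives : ∀ (A : Fin n → Bool) (P : Packet) → (if any (λ u → A u ∧ false) then just P else nothing) ≡ nothing
  nobody-receives A P = cong (λ z → if z then just P else nothing) (any-false _ (λ u → ∧-zeroʳ (A u)))

  module _ (t : ℕ) (e : G (suc t) ≈G G t) (φ : ℕ) (Ds : Fin n → Fin n → Fin n → Bool)
           (nk : ∀ w → StateIs (cfg t w) w (G 0) (G t) φ nothing nothing nothing (Ds w)) where
    no-newPacket : ∀ u → newPacket (cfg t u) (adj (G (suc t)) u) ≡ nothing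
    no-newPacket u = newPacket-none _ _
      (no-detection t e (G t) (λ _ _ → refl) φ (λ _ → nothing) (λ _ → nothing) (λ _ → nothing) Ds nk u)

    nothing-sent : ∀ u → (if isZero φ then (newPacket (cfg t u) (adj (G (suc t)) u) <∣> nothing) else nothing) ≡ nothing
    nothing-sent u rewrite no-newPacket u with isZero φ
    ... | true = refl
    ... | false = refl

    nothing-pending : ∀ u → (if isZero φ then nothing else (newPacket (cfg t u) (adj (G (suc t)) u) <∣> nothing)) ≡ nothing
    nothing-pending u rewrite no-newPacket u with isZero φ
    ... | true = refl
    ... | false = refl

    -- No node sends, so the packet handed to the round lemmas is arbitrary.
    quiet-round-end : (suc φ ≡ᵇ m) ≡ true → suc φ ≡ m →
      ∀ w → StateIs (cfg (suc t) w) w (G 0) (G (suc t)) 0 nothing nothing nothing (Ds w)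
    quiet-round-end eb em w =
      StateIs-cong (round-end (cfg t) (G 0) (G t) (G (suc t)) φ (λ _ → nothing) (λ _ → nothing) (λ _ → nothing) Ds nk
                      (λ _ → nothing) (no-detection t e (G t) (λ _ _ → refl) φ (λ _ → nothing) (λ _ → nothing) (λ _ → nothing) Ds nk)
                      (withHops (w , w) 0) (λ _ → false) nothing-sent (λ u _ → ≡sym (nobody-receives (adj (G (suc t)) u) _))
                      (λ { (u , ()) }) eb em w)
        (λ u → refl) (cong₂ _<∣>_ (nothing-pending w) (cong forward (nobody-receives (adj (G (suc t)) w) _))) (λ ()) (λ ())
        (λ a b → cong (λ P → learnt P a b ∨ (false ∨ Ds w a b)) (nobody-receives (adj (G (suc t)) w) _))

    quiet-round-mid : (suc φ ≡ᵇ m) ≡ false →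
      ∀ w → StateIs (cfg (suc t) w) w (G 0) (G (suc t)) (suc φ) nothing nothing nothing (Ds w)
    quiet-round-mid eb w =
      StateIs-cong (round-mid (cfg t) (G 0) (G t) (G (suc t)) φ (λ _ → nothing) (λ _ → nothing) (λ _ → nothing) Ds nk
                      (λ _ → nothing) (no-detection t e (G t) (λ _ _ → refl) φ (λ _ → nothing) (λ _ → nothing) (λ _ → nothing) Ds nk)
                      (withHops (w , w) 0) (λ _ → false) nothing-sent (λ u _ → ≡sym (nobody-receives (adj (G (suc t)) u) _)) eb w)
        (λ u → refl) (nothing-pending w) (λ _ → nothing-sent w) (λ _ → nobody-receives (adj (G (suc t)) w) _) (λ a b → refl)

  quiet-step : ∀ t → G (suc t) ≈G G t → Quiet t → Quiet (suc t)
  quiet-step t e (φ , Ds , lt , nk , good) with phase-advance φ lt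
  ... | inj₁ (eb , em) = 0 , Ds , s≤s z≤n , quiet-round-end t e φ Ds nk eb em ,
                         Consistent-cong (G t) (G (suc t)) Ds (λ a b → ≡sym (e a b)) good
  ... | inj₂ (eb , lt') = suc φ , Ds , lt' , quiet-round-mid t e φ Ds nk eb ,
                          Consistent-cong (G t) (G (suc t)) Ds (λ a b → ≡sym (e a b)) good

  <ᵇR⇒< : ∀ q → (q <ᵇ R) ≡ true → suc q ≤ R
  <ᵇR⇒< q e = <ᵇ⇒< q R (subst T (≡sym e) tt)

  <ᵇR-pred : ∀ q → (suc q <ᵇ R) ≡ true → (q <ᵇ R) ≡ true
  <ᵇR-pred q e = Equivalence.to T-≡ (<⇒<ᵇ (≤-trans (n≤1+n (suc q)) (<ᵇR⇒< (suc q) e)))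

  -- The flood of the deleted edge xy through the graph Gi: in stage q the nodes at walk length
  -- exactly q < R from an endpoint send the packet with hop count q + 1.
  module Wave (x y : Fin n) (Gi : Graph n) (Ds : Fin n → Fin n → Fin n → Bool) where
    isEndpoint : Fin n → Bool
    isEndpoint w = eqB x w ∨ eqB y w
    sends : ℕ → Fin n → Bool
    sends q w = (q <ᵇ R) ∧ walk (adj Gi) isEndpoint q w
    receives : ℕ → Fin n → Bool
    receives q w = any (λ u → adj Gi w u ∧ sends q u)
    learned : ℕ → Fin n → Bool
    learned zero w = isEndpoint w
    learned (suc q) w = learned q w ∨ ((q <ᵇ R) ∧ walk (adj Gi) isEndpoint (suc q) w)
    pk : ℕ → Packet
    pk h = withHops (orient x y) h
    ifP : Bool → ℕ → Maybe Packet
    ifP b h = if b then just (pk h) else nothing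

    Announcing : (Fin n → NodeState) → ℕ → Set
    Announcing c φ = ∀ w → StateIs (c w) w (G 0) Gi φ (ifP (isEndpoint w) 1) nothing nothing
                        (λ a b → (isEndpoint w ∧ sameEdge (x , y) a b) ∨ Ds w a b)
    Forwarding : (Fin n → NodeState) → ℕ → ℕ → Set
    Forwarding c q φ = ∀ w → StateIs (c w) w (G 0) Gi φ (if isZero φ then ifP (sends q w) (suc q) else nothing)
                         (ifP (sends q w) (suc q)) (ifP (receives q w) (suc q))
                         (λ a b → (learned q w ∧ sameEdge (x , y) a b) ∨ Ds w a b)

    receives≡ : ∀ q w → receives q w ≡ (q <ᵇ R) ∧ walk (adj Gi) isEndpoint (suc q) w
    receives≡ q w = any-∧-const (adj Gi w) (walk (adj Gi) isEndpoint q) (q <ᵇ R)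

    learnt-ifP : ∀ b h a c → learnt (ifP b h) a c ≡ b ∧ sameEdge (x , y) a c
    learnt-ifP true h a c = sameEdge-orient x y a c
    learnt-ifP false h a c = refl

    forward-ifP′ : ∀ b q → forward (ifP b (suc q)) ≡ (if b then (if suc q <ᵇ R then just (pk (suc (suc q))) else nothing) else nothing)
    forward-ifP′ true q = refl
    forward-ifP′ false q = refl

    if-∧-if : ∀ (a a' wv : Bool) (P : Maybe Packet) → (a' ≡ true → a ≡ true) →
      (if (a ∧ wv) then (if a' then P else nothing) else nothing) ≡ (if (a' ∧ wv) then P else nothing)
    if-∧-if true true true P h = refl
    if-∧-if true true false P h = refl
    if-∧-if true false true P h = refl
    if-∧-if true false false P h = refl
    if-∧-if false true wv P h = ⊥-elim (t≢f (h refl) refl)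
    if-∧-if false false wv P h = refl

    forward-ifP : ∀ q wv → forward (ifP ((q <ᵇ R) ∧ wv) (suc q)) ≡ ifP ((suc q <ᵇ R) ∧ wv) (suc (suc q))
    forward-ifP q wv = trans (forward-ifP′ ((q <ᵇ R) ∧ wv) q) (if-∧-if (q <ᵇ R) (suc q <ᵇ R) wv (just (pk (suc (suc q)))) (<ᵇR-pred q))

    module ForwardStep (t q φ : ℕ) (lt : φ < m) (e : ∀ c d → adj (G (suc t)) c d ≡ adj Gi c d)
                  (nk : Forwarding (cfg t) q φ) where
      pV oV bV : Fin n → Maybe Packet
      pV w = if isZero φ then ifP (sends q w) (suc q) else nothing
      oV w = ifP (sends q w) (suc q)
      bV w = ifP (receives q w) (suc q)
      DV : Fin n → Fin n → Fin n → Bool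
      DV w a b = (learned q w ∧ sameEdge (x , y) a b) ∨ Ds w a b

      detN : ∀ w → detect (cfg t w) (adj (G (suc t)) w) ≡ nothing
      detN w = detect-none _ _ (λ u → trans (StateIs.nb≡ (nk w) u) (≡sym (e w u)))

      npN : ∀ w → newPacket (cfg t w) (adj (G (suc t)) w) ≡ nothing
      npN w = newPacket-none _ _ (detN w)

      sentEq : ∀ u → (if isZero φ then (newPacket (cfg t u) (adj (G (suc t)) u) <∣> pV u) else oV u) ≡ ifP (sends q u) (suc q)
      sentEq u rewrite npN u with isZero φ
      ... | true = refl
      ... | false = refl

      recvEq : ∀ w → (if any (λ u → adj (G (suc t)) w u ∧ sends q u) then just (pk (suc q)) else nothing) ≡ bV w
      recvEq w = cong (λ z → if z then just (pk (suc q)) else nothing) (any-cong _ _ (λ u → cong (_∧ sends q u) (e w u)))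

      bufOK : ∀ w → isZero φ ≡ false → bV w ≡ (if any (λ u → adj (G (suc t)) w u ∧ sends q u) then just (pk (suc q)) else nothing)
      bufOK w _ = ≡sym (recvEq w)

      dec' : (∃ λ u → sends q u ≡ true) → decode (chunksUpTo (just (pk (suc q))) m) ≡ just (pk (suc q))
      dec' (u , s) = decOK _ _ (suc q) (<ᵇR⇒< q (proj₁ (∧-elim {q <ᵇ R} s)))

      pendNE : ∀ w → (if isZero φ then nothing else (newPacket (cfg t w) (adj (G (suc t)) w) <∣> pV w)) ≡ nothing
      pendNE w rewrite npN w with isZero φ
      ... | true = refl
      ... | false = refl

      step-mid : (suc φ ≡ᵇ m) ≡ false → Forwarding (cfg (suc t)) q (suc φ)
      step-mid eb w = StateIs-cong (round-mid (cfg t) (G 0) Gi (G (suc t)) φ pV oV bV DV nk (λ _ → nothing) detN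
                               (pk (suc q)) (sends q) sentEq bufOK eb w)
                      (e w) (pendNE w) (λ _ → sentEq w) (λ _ → recvEq w) (λ a b → refl)

      step-end : (suc φ ≡ᵇ m) ≡ true → suc φ ≡ m → Forwarding (cfg (suc t)) (suc q) 0
      step-end eb e' w = StateIs-cong (round-end (cfg t) (G 0) Gi (G (suc t)) φ pV oV bV DV nk (λ _ → nothing) detN
                               (pk (suc q)) (sends q) sentEq bufOK dec' eb e' w)
                      (e w) pendE (λ ()) (λ ()) DE
        where
        pendE : ((if isZero φ then nothing else (newPacket (cfg t w) (adj (G (suc t)) w) <∣> pV w)) <∣>
                  forward (if any (λ u → adj (G (suc t)) w u ∧ sends q u) then just (pk (suc q)) else nothing))
                ≡ ifP (sends (suc q) w) (suc (suc q))
        pendE = trans (cong₂ _<∣>_ (pendNE w) (cong forward (recvEq w)))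
                  (trans (cong (λ z → forward (ifP z (suc q))) (receives≡ q w)) (forward-ifP q (walk (adj Gi) isEndpoint (suc q) w)))
        DE : ∀ a b → learnt (if any (λ u → adj (G (suc t)) w u ∧ sends q u) then just (pk (suc q)) else nothing) a b
                      ∨ (false ∨ DV w a b) ≡ (learned (suc q) w ∧ sameEdge (x , y) a b) ∨ Ds w a b
        DE a b = trans (cong (λ z → learnt z a b ∨ DV w a b) (recvEq w))
                 (trans (cong (_∨ DV w a b) (learnt-ifP (receives q w) (suc q) a b))
                 (trans (∧-∨-collect (receives q w) (learned q w) (sameEdge (x , y) a b) (Ds w a b))
                 (cong (λ z → ((learned q w ∨ z) ∧ sameEdge (x , y) a b) ∨ Ds w a b) (receives≡ q w))))



  module AnnounceStep (x y : Fin n) (Gi : Graph n) (Ds : Fin n → Fin n → Fin n → Bool)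
     (t φ : ℕ) (lt : φ < m) (nz : isZero φ ≡ false) (e : ∀ c d → adj (G (suc t)) c d ≡ adj Gi c d)
     (nk : Wave.Announcing x y Gi Ds (cfg t) φ) where
    open Wave x y Gi Ds
    pV oV bV : Fin n → Maybe Packet
    pV w = ifP (isEndpoint w) 1
    oV w = nothing
    bV w = nothing
    DV : Fin n → Fin n → Fin n → Bool
    DV w a b = (isEndpoint w ∧ sameEdge (x , y) a b) ∨ Ds w a b

    detN : ∀ w → detect (cfg t w) (adj (G (suc t)) w) ≡ nothing
    detN w = detect-none _ _ (λ u → trans (StateIs.nb≡ (nk w) u) (≡sym (e w u)))

    npN : ∀ w → newPacket (cfg t w) (adj (G (suc t)) w) ≡ nothing
    npN w = newPacket-none _ _ (detN w)

    sentEq : ∀ u → (if isZero φ then (newPacket (cfg t u) (adj (G (suc t)) u) <∣> pV u) else oV u) ≡ nothing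
    sentEq u rewrite nz = refl

    recvN : ∀ w → (if any (λ u → adj (G (suc t)) w u ∧ false) then just (pk 1) else nothing) ≡ nothing
    recvN w = nobody-receives (adj (G (suc t)) w) (pk 1)

    pendNE : ∀ w → (if isZero φ then nothing else (newPacket (cfg t w) (adj (G (suc t)) w) <∣> pV w)) ≡ ifP (isEndpoint w) 1
    pendNE w rewrite nz | npN w = refl

    step-mid : (suc φ ≡ᵇ m) ≡ false → Announcing (cfg (suc t)) (suc φ)
    step-mid eb w = StateIs-cong (round-mid (cfg t) (G 0) Gi (G (suc t)) φ pV oV bV DV nk (λ _ → nothing) detN
                             (pk 1) (λ _ → false) sentEq (λ w _ → ≡sym (recvN w)) eb w)
                    (e w) (pendNE w) (λ _ → sentEq w) (λ _ → recvN w) (λ a b → refl)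

    step-end : (suc φ ≡ᵇ m) ≡ true → suc φ ≡ m → Forwarding (cfg (suc t)) 0 0
    step-end eb e' w = StateIs-cong (round-end (cfg t) (G 0) Gi (G (suc t)) φ pV oV bV DV nk (λ _ → nothing) detN
                             (pk 1) (λ _ → false) sentEq (λ w _ → ≡sym (recvN w)) (λ { (_ , ()) }) eb e' w)
                    (e w) pendE (λ ()) (λ ()) DE
      where
      pendE : ((if isZero φ then nothing else (newPacket (cfg t w) (adj (G (suc t)) w) <∣> pV w)) <∣>
                forward (if any (λ u → adj (G (suc t)) w u ∧ false) then just (pk 1) else nothing)) ≡ ifP (isEndpoint w) 1
      pendE = trans (cong₂ _<∣>_ (pendNE w) (cong forward (recvN w))) (<∣>-identityʳ _)
      DE : ∀ a b → learnt (if any (λ u → adj (G (suc t)) w u ∧ false) then just (pk 1) else nothing) a b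
                    ∨ (false ∨ DV w a b) ≡ (learned 0 w ∧ sameEdge (x , y) a b) ∨ Ds w a b
      DE a b = cong (λ z → learnt z a b ∨ DV w a b) (recvN w)

  -- Until round b1 the endpoints hold the packet (t + m = b1 + φ); from b1 on, round t is round φ of stage q.
  FloodProgress : Fin n → Fin n → Graph n → (Fin n → Fin n → Fin n → Bool) → ℕ → ℕ → Set
  FloodProgress x y Gi Ds b1 t =
    (Σ ℕ λ φ → t + m ≡ b1 + φ × isZero φ ≡ false × φ < m × Wave.Announcing x y Gi Ds (cfg t) φ)
    ⊎ (Σ ℕ λ q → Σ ℕ λ φ → t ≡ b1 + q * m + φ × φ < m × Wave.Forwarding x y Gi Ds (cfg t) q φ)

  -- The edge xy was deleted in round i0 + 1; its flood starts at the phase boundary b1.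
  record Flooding (t : ℕ) : Set where
    field
      i0 : ℕ
      x y : Fin n
      xy : adj (G i0) x y ≡ true
      del : ∀ c d → adj (G (suc i0)) c d ≡ adj (G i0) c d ∧ not (sameEdge (x , y) c d)
      lt : suc i0 ≤ t
      same : ∀ c d → adj (G t) c d ≡ adj (G (suc i0)) c d
      b1 : ℕ
      b1≥ : i0 ≤ b1
      b1≤ : b1 ≤ i0 + m'
      Ds : Fin n → Fin n → Fin n → Bool
      good : Consistent (G i0) Ds
      desc : FloodProgress x y (G (suc i0)) Ds b1 t

  flooding-step : ∀ t → G (suc t) ≈G G t → Flooding t → Flooding (suc t)
  flooding-step t e F = record
    { i0 = i0 ; x = x ; y = y ; xy = xy ; del = del ; lt = ≤-trans lt (n≤1+n t)
    ; same = λ c d → trans (e c d) (same c d) ; b1 = b1 ; b1≥ = b1≥ ; b1≤ = b1≤ ; Ds = Ds ; good = good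
    ; desc = desc' desc }
    where
    open Flooding F
    e' : ∀ c d → adj (G (suc t)) c d ≡ adj (G (suc i0)) c d
    e' c d = trans (e c d) (same c d)
    desc' : FloodProgress x y (G (suc i0)) Ds b1 t → FloodProgress x y (G (suc i0)) Ds b1 (suc t)
    desc' (inj₁ (φ , tm , nz , ltφ , nk)) with phase-advance φ ltφ
    ... | inj₁ (eb , em) = inj₂ (0 , 0 , tb , s≤s z≤n , AnnounceStep.step-end x y (G (suc i0)) Ds t φ ltφ nz e' nk eb em)
      where
      tb : suc t ≡ b1 + 0 * m + 0
      tb = trans (+-cancelʳ-≡ m (suc t) b1 (trans (cong suc tm) (trans (≡sym (+-suc b1 φ)) (cong (b1 +_) em))))
                 (≡sym (trans (+-identityʳ _) (+-identityʳ b1)))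
    ... | inj₂ (eb , lt') = inj₁ (suc φ , trans (cong suc tm) (≡sym (+-suc b1 φ)) , refl , lt' ,
                                  AnnounceStep.step-mid x y (G (suc i0)) Ds t φ ltφ nz e' nk eb)
    desc' (inj₂ (q , φ , tq , ltφ , nk)) with phase-advance φ ltφ
    ... | inj₁ (eb , em) = inj₂ (suc q , 0 , tb , s≤s z≤n , Wave.ForwardStep.step-end x y (G (suc i0)) Ds t q φ ltφ e' nk eb em)
      where
      tb : suc t ≡ b1 + suc q * m + 0
      tb = trans (cong suc tq) (subst (λ z → suc (b1 + q * z + φ) ≡ b1 + suc q * z + 0) em (shift b1 q φ))
        where
        shift : ∀ b q φ → suc (b + q * suc φ + φ) ≡ b + suc q * suc φ + 0
        shift = solve-∀
    ... | inj₂ (eb , lt') = inj₂ (q , suc φ , trans (cong suc tq) (≡sym (+-suc _ φ)) , lt' ,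
                                  Wave.ForwardStep.step-mid x y (G (suc i0)) Ds t q φ ltφ e' nk eb)



  module Knowledge (x y w : Fin n) (Gold Gnew : Graph n)
    (del : ∀ c d → adj Gnew c d ≡ adj Gold c d ∧ not (sameEdge (x , y) c d))
    (Dold : Fin n → Fin n → Bool)
    (gsub : ∀ a b → adj Gold a b ≡ true → known Dold a b ≡ true)
    (gsf : StaleFree R Gold (known Dold) w)
    (l : Bool) (unl : l ≡ false → ∀ h → h ≤ R → walk (adj Gnew) (λ z → eqB x z ∨ eqB y z) h w ≡ false) where

    Dnew : Fin n → Fin n → Bool
    Dnew a b = (l ∧ sameEdge (x , y) a b) ∨ Dold a b

    known-new⇒old : ∀ a b → known Dnew a b ≡ true → known Dold a b ≡ true
    known-new⇒old a b p with ∧-elim {adj (G 0) a b} p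
    ... | p1 , p2 = ∧-intro p1 (proj₂ (not-∨-elim (l ∧ sameEdge (x , y) a b) (Dold a b) p2))

    Gnew⇒Gold : ∀ a b → adj Gnew a b ≡ true → adj Gold a b ≡ true × sameEdge (x , y) a b ≡ false
    Gnew⇒Gold a b p with ∧-elim {adj Gold a b} (trans (≡sym (del a b)) p)
    ... | p1 , p2 = p1 , Equivalence.to T-not-≡ (Equivalence.from T-≡ p2)

    deleted⇒sameEdge : ∀ a b → adj Gold a b ≡ true → adj Gnew a b ≡ false → sameEdge (x , y) a b ≡ true
    deleted⇒sameEdge a b old new with sameEdge (x , y) a b in e
    ... | true = refl
    ... | false = ⊥-elim (t≢f (trans (del a b) (cong₂ (λ u z → u ∧ not z) old e)) new)

    Gnew⊆known : ∀ a b → adj Gnew a b ≡ true → known Dnew a b ≡ true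
    Gnew⊆known a b p with Gnew⇒Gold a b p
    ... | p1 , p2 with ∧-elim {adj (G 0) a b} (gsub a b p1)
    ... | q1 , q2 rewrite p2 | ∧-zeroʳ l = ∧-intro q1 q2

    walk-to-endpoint : ∀ c d → sameEdge (x , y) c d ≡ true → ∀ h → walk (adj Gnew) (eqB c) h w ≡ true →
      walk (adj Gnew) (λ z → eqB x z ∨ eqB y z) h w ≡ true
    walk-to-endpoint c d pc h wc = walk-mono (adj Gnew) (adj Gnew) (eqB c) _ (λ _ _ z → z)
      (λ z ez → subst (λ u → (eqB x u ∨ eqB y u) ≡ true) (eqB-true {u = c} ez) (sameEdge⇒endpoint x y c d pc)) h w wc

    -- A walk in the new view either stays in Gnew up to the stale edge, or leaves Gnew earlier through an
    -- edge of the old view; either way it reaches a stale edge of the old view or an endpoint of xy.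
    stale-free : StaleFree R Gnew (known Dnew) w
    stale-free a b kab gab h le = ¬true⇒false stale-walk
      where
      stale-walk : walk (known Dnew) (eqB a) h w ≡ true → ⊥
      stale-walk wl with adj Gold a b in eg
      ... | false = t≢f (walk-mono (known Dnew) (known Dold) (eqB a) (eqB a) known-new⇒old (λ _ z → z) h w wl)
                        (gsf a b (known-new⇒old a b kab) eg h le)
      ... | true = go (walk-or-missing-edge (known Dold) (adj Gnew) a h w
                         (walk-mono (known Dnew) (known Dold) (eqB a) (eqB a) known-new⇒old (λ _ z → z) h w wl))
        where
        ab-deleted : sameEdge (x , y) a b ≡ true
        ab-deleted = deleted⇒sameEdge a b eg gab
        unlearned : l ≡ false
        unlearned = unlisted⇒false l (sameEdge (x , y) a b) (Dold a b) ab-deleted (proj₂ (∧-elim {adj (G 0) a b} kab))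
        go : _ → ⊥
        go (inj₁ wg) = t≢f (walk-to-endpoint a b ab-deleted h wg) (unl unlearned h le)
        go (inj₂ (c , d , h' , le' , wc , Acd , A'cd)) with adj Gold c d in eg'
        ... | false = t≢f (walk-mono (adj Gnew) (known Dold) (eqB c) (eqB c) (λ a b p → gsub a b (proj₁ (Gnew⇒Gold a b p)))
                            (λ _ z → z) h' w wc)
                          (gsf c d Acd eg' h' (≤-trans le' le))
        ... | true = t≢f (walk-to-endpoint c d (deleted⇒sameEdge c d eg' A'cd) h' wc) (unl unlearned h' (≤-trans le' le))


  module StartFlood (t : ℕ) (Ds : Fin n → Fin n → Fin n → Bool) (good : Consistent (G t) Ds)
    (x y : Fin n) (xy : adj (G t) x y ≡ true)
    (del : ∀ c d → adj (G (suc t)) c d ≡ adj (G t) c d ∧ not (sameEdge (x , y) c d)) where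
    open Wave x y (G (suc t)) Ds

    x≢y : x ≢ y
    x≢y refl = t≢f xy (irrefl (G t) x)

    det : Fin n → Maybe (Fin n)
    det w = if eqB x w then just y else (if eqB y w then just x else nothing)

    endpoint-cases : ∀ w → (w ≡ x × det w ≡ just y × isEndpoint w ≡ true) ⊎ (w ≡ y × det w ≡ just x × isEndpoint w ≡ true) ⊎
                 (w ≢ x × w ≢ y × det w ≡ nothing × isEndpoint w ≡ false)
    endpoint-cases w with w ≟F x | w ≟F y
    ... | yes refl | _ rewrite eqB-refl x = inj₁ (refl , refl , refl)
    ... | no nx | yes refl rewrite eqB-false x≢y | eqB-refl y = inj₂ (inj₁ (refl , refl , refl))
    ... | no nx | no ny rewrite eqB-false {u = x} {w} (λ e → nx (≡sym e)) | eqB-false {u = y} {w} (λ e → ny (≡sym e)) =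
          inj₂ (inj₂ (nx , ny , refl , refl))

    pmx : ∀ z → z ≢ y → sameEdge (x , y) x z ≡ false
    pmx z ne rewrite eqB-false {u = y} {z} (λ e → ne (≡sym e)) | eqB-false {u = y} {x} (λ e → x≢y (≡sym e))
                   | ∧-zeroʳ (eqB x x) | ∧-zeroʳ (eqB x z) = refl
    pmy : ∀ z → z ≢ x → sameEdge (x , y) y z ≡ false
    pmy z ne rewrite eqB-false x≢y | eqB-false {u = x} {z} (λ e → ne (≡sym e)) = refl
    pmo : ∀ w z → w ≢ x → w ≢ y → sameEdge (x , y) w z ≡ false
    pmo w z nx ny rewrite eqB-false {u = x} {w} (λ e → nx (≡sym e)) | eqB-false {u = y} {w} (λ e → ny (≡sym e))
                        | ∧-zeroʳ (eqB x z) = refl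
    pmyx : sameEdge (x , y) y x ≡ true
    pmyx rewrite eqB-refl x | eqB-refl y = ∨-zeroʳ _

    row-same : ∀ w z → sameEdge (x , y) w z ≡ false → adj (G (suc t)) w z ≡ adj (G t) w z
    row-same w z p = trans (del w z) (trans (cong (λ u → adj (G t) w z ∧ not u) p) (∧-identityʳ _))

    module _ (φ0 : ℕ) (nk : ∀ w → StateIs (cfg t w) w (G 0) (G t) φ0 nothing nothing nothing (Ds w)) where
      det≡ : ∀ w → detect (cfg t w) (adj (G (suc t)) w) ≡ det w
      det≡ w with endpoint-cases w
      ... | inj₁ (refl , dw , _) = trans (detect-one (cfg t x) (adj (G (suc t)) x) y
              (λ z ne → trans (StateIs.nb≡ (nk x) z) (≡sym (row-same x z (pmx z ne))))
              (trans (StateIs.nb≡ (nk x) y) xy) (trans (del x y) (cong₂ (λ u v → u ∧ not v) xy (sameEdge-refl x y)))) (≡sym dw)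
      ... | inj₂ (inj₁ (refl , dw , _)) = trans (detect-one (cfg t y) (adj (G (suc t)) y) x
              (λ z ne → trans (StateIs.nb≡ (nk y) z) (≡sym (row-same y z (pmy z ne))))
              (trans (StateIs.nb≡ (nk y) x) (trans (sym (G t) y x) xy))
              (trans (del y x) (cong₂ (λ u v → u ∧ not v) (trans (sym (G t) y x) xy) pmyx))) (≡sym dw)
      ... | inj₂ (inj₂ (nx , ny , dw , _)) = trans (detect-none (cfg t w) (adj (G (suc t)) w)
              (λ z → trans (StateIs.nb≡ (nk w) z) (≡sym (row-same w z (pmo w z nx ny))))) (≡sym dw)

      newPacket≡ : ∀ w → newPacket (cfg t w) (adj (G (suc t)) w) ≡ ifP (isEndpoint w) 1
      newPacket≡ w with endpoint-cases w
      ... | inj₁ (refl , dw , ie) rewrite ie =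
            trans (newPacket-one _ _ y (trans (det≡ x) dw)) (cong (λ u → just (withHops (orient u y) 1)) (StateIs.me≡ (nk x)))
      ... | inj₂ (inj₁ (refl , dw , ie)) rewrite ie =
            trans (newPacket-one _ _ x (trans (det≡ y) dw))
              (cong (λ u → just (withHops u 1)) (trans (cong (λ u → orient u x) (StateIs.me≡ (nk y))) (orient-sym y x (λ e → x≢y (≡sym e)))))
      ... | inj₂ (inj₂ (nx , ny , dw , ie)) rewrite ie = newPacket-none _ _ (trans (det≡ w) dw)

      detected≡ : ∀ w a b → detected (det w) w a b ≡ isEndpoint w ∧ sameEdge (x , y) a b
      detected≡ w a b with endpoint-cases w
      ... | inj₁ (refl , dw , ie) rewrite dw | ie = refl
      ... | inj₂ (inj₁ (refl , dw , ie)) rewrite dw | ie = sameEdge-swap x y a b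
      ... | inj₂ (inj₂ (nx , ny , dw , ie)) rewrite dw | ie = refl

    recvN : ∀ w → (if any (λ u → adj (G (suc t)) w u ∧ false) then just (pk 1) else nothing) ≡ nothing
    recvN w = nobody-receives (adj (G (suc t)) w) (pk 1)

    started : ∀ b1 → t ≤ b1 → b1 ≤ t + m' → FloodProgress x y (G (suc t)) Ds b1 (suc t) → Flooding (suc t)
    started b1 b1≥ b1≤ desc = record { i0 = t ; x = x ; y = y ; xy = xy ; del = del ; lt = ≤-refl ; same = λ c d → refl
      ; b1 = b1 ; b1≥ = b1≥ ; b1≤ = b1≤ ; Ds = Ds ; good = good ; desc = desc }

    flood-started : ∀ φ0 → φ0 < m → (∀ w → StateIs (cfg t w) w (G 0) (G t) φ0 nothing nothing nothing (Ds w)) → Flooding (suc t)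
    flood-started zero lt0 nk with phase-advance 0 lt0
    ... | inj₂ (eb , lt') = started t ≤-refl (m≤m+n t m') (inj₂ (0 , 1 , tq , lt' , nokNE))
      where
      tq : suc t ≡ t + 0 * m + 1
      tq = ≡sym (trans (cong (_+ 1) (+-identityʳ t)) (+-comm t 1))
      sentEq0 : ∀ u → (if isZero 0 then (newPacket (cfg t u) (adj (G (suc t)) u) <∣> nothing) else nothing) ≡ (if isEndpoint u then just (pk 1) else nothing)
      sentEq0 u = trans (<∣>-identityʳ _) (newPacket≡ 0 nk u)
      nokNE : Forwarding (cfg (suc t)) 0 1
      nokNE w = StateIs-cong (round-mid (cfg t) (G 0) (G t) (G (suc t)) 0 (λ _ → nothing) (λ _ → nothing) (λ _ → nothing) Ds nk
                   det (det≡ 0 nk) (pk 1) isEndpoint sentEq0 (λ w ()) eb w)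
                 (λ u → refl) refl (λ _ → sentEq0 w) (λ _ → refl) (λ a b → cong (_∨ Ds w a b) (detected≡ 0 nk w a b))
    ... | inj₁ (eb , em) = started t ≤-refl (m≤m+n t m') (inj₂ (1 , 0 , tq1 , s≤s z≤n , nokE))
      where
      tq1 : suc t ≡ t + 1 * m + 0
      tq1 = subst (λ z → suc t ≡ t + 1 * z + 0) em (≡sym (trans (+-identityʳ _) (+-comm t 1)))
      sentEq0 : ∀ u → (if isZero 0 then (newPacket (cfg t u) (adj (G (suc t)) u) <∣> nothing) else nothing) ≡ (if isEndpoint u then just (pk 1) else nothing)
      sentEq0 u = trans (<∣>-identityʳ _) (newPacket≡ 0 nk u)
      nokE : Forwarding (cfg (suc t)) 1 0
      nokE w = StateIs-cong (round-end (cfg t) (G 0) (G t) (G (suc t)) 0 (λ _ → nothing) (λ _ → nothing) (λ _ → nothing) Ds nk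
                   det (det≡ 0 nk) (pk 1) isEndpoint sentEq0 (λ w ()) (λ _ → decOK _ _ 1 (s≤s z≤n)) eb em w)
                 (λ u → refl)
                 (trans (cong (λ z → forward (ifP z 1)) (receives≡ 0 w)) (forward-ifP 0 (walk (adj (G (suc t))) isEndpoint 1 w)))
                 (λ ()) (λ ())
                 (λ a b → trans (cong₂ (λ u v → u ∨ (v ∨ Ds w a b)) (learnt-ifP (receives 0 w) 1 a b) (detected≡ 0 nk w a b))
                           (trans (∧-∨-collect (receives 0 w) (isEndpoint w) (sameEdge (x , y) a b) (Ds w a b))
                                  (cong (λ z → ((isEndpoint w ∨ z) ∧ sameEdge (x , y) a b) ∨ Ds w a b) (receives≡ 0 w))))
    flood-started (suc φ') lt0 nk with phase-advance (suc φ') lt0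
    ... | inj₂ (eb , lt') = started (t + (m ∸ suc φ')) (m≤m+n t _) (+-monoʳ-≤ t (m∸n≤m m' φ'))
                              (inj₁ (suc (suc φ') , tm , refl , lt' , nokP))
      where
      tm : suc t + m ≡ t + (m ∸ suc φ') + suc (suc φ')
      tm = ≡sym (trans (+-assoc t (m ∸ suc φ') (suc (suc φ')))
             (trans (cong (t +_) (trans (+-suc (m ∸ suc φ') (suc φ')) (cong suc (m∸n+n≡m (<⇒≤ lt0)))))
                    (+-suc t m)))
      nokP : Announcing (cfg (suc t)) (suc (suc φ'))
      nokP w = StateIs-cong (round-mid (cfg t) (G 0) (G t) (G (suc t)) (suc φ') (λ _ → nothing) (λ _ → nothing) (λ _ → nothing) Ds nk
                   det (det≡ (suc φ') nk) (pk 1) (λ _ → false) (λ u → refl) (λ w _ → ≡sym (recvN w)) eb w)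
                 (λ u → refl) (trans (<∣>-identityʳ _) (newPacket≡ (suc φ') nk w)) (λ _ → refl) (λ _ → recvN w)
                 (λ a b → cong (_∨ Ds w a b) (detected≡ (suc φ') nk w a b))
    ... | inj₁ (eb , em) = started (t + (m ∸ suc φ')) (m≤m+n t _) (+-monoʳ-≤ t (m∸n≤m m' φ'))
                             (inj₂ (0 , 0 , tq , s≤s z≤n , nokE))
      where
      tq : suc t ≡ t + (m ∸ suc φ') + 0 * m + 0
      tq = subst (λ z → suc t ≡ t + (z ∸ suc φ') + 0 * z + 0) em (≡sym (trans (+-identityʳ _) (trans (+-identityʳ _) (trans (cong (t +_) (m+n∸n≡m 1 (suc φ'))) (+-comm t 1)))))
      nokE : Forwarding (cfg (suc t)) 0 0
      nokE w = StateIs-cong (round-end (cfg t) (G 0) (G t) (G (suc t)) (suc φ') (λ _ → nothing) (λ _ → nothing) (λ _ → nothing) Ds nk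
                   det (det≡ (suc φ') nk) (pk 1) (λ _ → false) (λ u → refl) (λ w _ → ≡sym (recvN w)) (λ { (_ , ()) }) eb em w)
                 (λ u → refl)
                 (trans (cong₂ _<∣>_ (trans (<∣>-identityʳ _) (newPacket≡ (suc φ') nk w)) (cong forward (recvN w))) (<∣>-identityʳ _))
                 (λ ()) (λ ())
                 (λ a b → trans (cong (λ z → learnt z a b ∨ (detected (det w) w a b ∨ Ds w a b)) (recvN w))
                                (cong (_∨ Ds w a b) (detected≡ (suc φ') nk w a b)))



  learned-complete : ∀ x y Gi Ds w q h → h ≤ q → h ≤ R → walk (adj Gi) (Wave.isEndpoint x y Gi Ds) h w ≡ true → Wave.learned x y Gi Ds q w ≡ true
  learned-complete x y Gi Ds w zero zero _ _ p = p
  learned-complete x y Gi Ds w (suc q) h le lr p with m≤n⇒m<n∨m≡n le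
  ... | inj₁ (s≤s le') = ∨-introˡ _ (learned-complete x y Gi Ds w q h le' lr p)
  ... | inj₂ refl = ∨-introʳ (Wave.learned x y Gi Ds q w) (∧-intro (Equivalence.to T-≡ (<⇒<ᵇ lr)) p)

  ≥R⇒<ᵇR-false : ∀ q → R ≤ q → (q <ᵇ R) ≡ false
  ≥R⇒<ᵇR-false q le with q <ᵇ R in e
  ... | false = refl
  ... | true = ⊥-elim (<-irrefl refl (≤-trans (<ᵇR⇒< q e) le))

  m'≤ : m' + R * m ≤ r
  m'≤ = ≤-pred timing

  flood-finished : ∀ t (F : Flooding t) → Flooding.i0 F + r ≤ t →
    let open Flooding F in Σ ℕ λ q → Σ ℕ λ φ → R ≤ q × φ < m × Wave.Forwarding x y (G (suc i0)) Ds (cfg t) q φ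
  flood-finished t F le with Flooding.desc F
  ... | inj₁ (φ , tm , nz , ltφ , nk) = ⊥-elim (<-irrefl refl (≤-<-trans le tlt))
    where
    open Flooding F
    tlt : t < i0 + r
    tlt = +-cancelʳ-< m t (i0 + r) (≤-trans (≤-reflexive (cong suc tm)) (≤-trans (+-monoʳ-< b1 ltφ)
             (+-monoˡ-≤ m (≤-trans b1≤ (+-monoʳ-≤ i0 (≤-trans (m≤m+n m' (R * m)) m'≤))))))
  ... | inj₂ (q , φ , tq , ltφ , nk) with R ≤? q
  ... | no nRq = ⊥-elim (<-irrefl refl (≤-<-trans le tlt))
    where
    open Flooding F
    tlt : t < i0 + r
    tlt = ≤-trans (≤-reflexive (cong suc tq)) (≤-trans (s1 b1 q φ ltφ)
            (≤-trans (+-monoʳ-≤ b1 (*-monoˡ-≤ m (≮⇒≥ (λ x → nRq (≤-pred x)))))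
            (≤-trans (+-monoˡ-≤ (R * m) b1≤) (≤-trans (≤-reflexive (+-assoc i0 m' (R * m))) (+-monoʳ-≤ i0 m'≤)))))
      where
      s1 : ∀ b q φ → φ < m → suc (b + q * m + φ) ≤ b + suc q * m
      s1 b q φ lt = ≤-trans (≤-reflexive (≡sym (+-suc (b + q * m) φ))) (≤-trans (+-monoʳ-≤ (b + q * m) lt) (≤-reflexive (eqn b q)))
        where
        eqn : ∀ b q → b + q * m + m ≡ b + suc q * m
        eqn b q = trans (+-assoc b (q * m) m) (cong (b +_) (+-comm (q * m) m))
  ... | yes Rq = q , φ , Rq , ltφ , nk

  flooding-done : ∀ t → (F : Flooding t) → Flooding.i0 F + r ≤ t → Quiet t
  flooding-done t F le with flood-finished t F le
  ... | q , φ , Rq , ltφ , nk = φ , Dn , ltφ , nokQ , goodN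
    where
    open Flooding F
    open Wave x y (G (suc i0)) Ds
    lf = ≥R⇒<ᵇR-false q Rq
    sF : ∀ w → sends q w ≡ false
    sF w rewrite lf = refl
    rF : ∀ w → receives q w ≡ false
    rF w = trans (receives≡ q w) (cong (_∧ walk (adj (G (suc i0))) isEndpoint (suc q) w) lf)
    Dn : Fin n → Fin n → Fin n → Bool
    Dn w a b = (learned q w ∧ sameEdge (x , y) a b) ∨ Ds w a b
    nokQ : ∀ w → StateIs (cfg t w) w (G 0) (G t) φ nothing nothing nothing (Dn w)
    nokQ w = StateIs-cong (nk w) (λ u → ≡sym (same w u)) pe (λ _ → cong (λ z → ifP z (suc q)) (sF w))
               (λ _ → cong (λ z → ifP z (suc q)) (rF w)) (λ a b → refl)
      where
      pe : (if isZero φ then ifP (sends q w) (suc q) else nothing) ≡ nothing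
      pe rewrite sF w with isZero φ
      ... | true = refl
      ... | false = refl
    goodN : Consistent (G t) Dn
    goodN w = let open Knowledge x y w (G i0) (G (suc i0)) del (Ds w) (proj₁ (good w)) (proj₂ (good w)) (learned q w)
                    (λ lf' h hR → ¬true⇒false (λ p → t≢f (learned-complete x y (G (suc i0)) Ds w q h (≤-trans hR Rq) hR p) lf'))
              in (λ a b p → Gnew⊆known a b (trans (≡sym (same a b)) p)) , (λ a b p p' → stale-free a b p (trans (≡sym (same a b)) p'))

  Invariant : ℕ → Set
  Invariant t = Quiet t ⊎ Flooding t

  flood-over-at-deletion : ∀ t → (F : Flooding t) → ¬ (G (suc t) ≈G G t) → Flooding.i0 F + r ≤ t
  flood-over-at-deletion t F chg with r ≤? (t ∸ i0)
    where open Flooding F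
  ... | yes le = ≤-trans (+-monoʳ-≤ i0 le) (≤-reflexive (m+[n∸m]≡n (≤-trans (n≤1+n i0) lt)))
    where open Flooding F
  ... | no nle = ⊥-elim (chg (subst (λ z → G (suc z) ≈G G z) (m+[n∸m]≡n (≤-trans (n≤1+n i0) lt))
                   (prom i0 (t ∸ i0) d1 (≰⇒> nle) (deletion-changes (G i0) (G (suc i0)) x y xy del))))
    where
    open Flooding F
    d1 : 1 ≤ t ∸ i0
    d1 = m<n⇒0<n∸m lt

  quiet-before-deletion : ∀ t → ¬ (G (suc t) ≈G G t) → Invariant t → Quiet t
  quiet-before-deletion t chg (inj₁ q) = q
  quiet-before-deletion t chg (inj₂ F) = flooding-done t F (flood-over-at-deletion t F chg)

  adj-mono-step : ∀ t c d → adj (G (suc t)) c d ≡ true → adj (G t) c d ≡ true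
  adj-mono-step t c d p with eds t
  ... | inj₁ e = trans (≡sym (e c d)) p
  ... | inj₂ (x , y , xy , sp) = proj₁ (Equivalence.to (sp c d) p)

  adj-mono : ∀ j l c d → adj (G (l + j)) c d ≡ true → adj (G j) c d ≡ true
  adj-mono j zero c d p = p
  adj-mono j (suc l) c d p = adj-mono j l c d (adj-mono-step (l + j) c d p)

  invariant : ∀ t → Invariant t
  invariant zero = inj₁ quiet-init
  invariant (suc t) with eds t | invariant t
  ... | inj₁ e | inj₁ q = inj₁ (quiet-step t e q)
  ... | inj₁ e | inj₂ F = inj₂ (flooding-step t e F)
  ... | inj₂ (x , y , xy , sp) | I = inj₂ (start (quiet-before-deletion t (deletion-changes (G t) (G (suc t)) x y xy dl) I))
    where
    dl = deletion-adj (G t) (G (suc t)) x y sp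
    start : Quiet t → Flooding (suc t)
    start (φ , Ds , lt , nk , good) = StartFlood.flood-started t Ds good x y xy dl φ lt nk

  quiet-when-settled : ∀ t → G (t ∸ (r ∸ 1)) ≈G G t → Quiet t
  quiet-when-settled t e with invariant t
  ... | inj₁ q = q
  ... | inj₂ F with (Flooding.i0 F + r) ≤? t
  ... | yes le = flooding-done t F le
  ... | no nle = ⊥-elim (t≢f (trans (≡sym (e x y)) old) now)
    where
    open Flooding F
    j = t ∸ (r ∸ 1)
    jle : j ≤ i0
    jle = t∸[r∸1]≤i t i0 r (≮⇒≥ λ z → nle (≤-pred z))
    old : adj (G j) x y ≡ true
    old = adj-mono j (i0 ∸ j) x y (subst (λ z → adj (G z) x y ≡ true) (≡sym (trans (+-comm (i0 ∸ j) j) (m+[n∸m]≡n jle))) xy)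
    now : adj (G t) x y ≡ false
    now = trans (same x y) (trans (del x y) (cong₂ (λ u v → u ∧ not v) xy (sameEdge-refl x y)))

  output-correct : ∀ t → G (t ∸ (r ∸ 1)) ≈G G t → ∀ v F →
    CorrectOutput H (G t) v (outF (cfg t v) F) F
  output-correct t e v F with quiet-when-settled t e
  ... | (φ , Ds , lt , nk , good) = ⇔-trans (does⇔ (memListCopy? H (deleteEdges (g0 s) (D s)) (me s) F)) (⇔-sym (at-v eqv))
    where
    s = cfg t v
    nkv = nk v
    K' : Graph n
    K' = deleteEdges (G 0) (D s)
    kEq : ∀ a b → adj K' a b ≡ known (Ds v) a b
    kEq a b = cong (λ z → adj (G 0) a b ∧ not z) (StateIs.D≡ nkv a b)
    sub : ∀ i j → adj (G t) i j ≡ true → adj K' i j ≡ true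
    sub i j p = trans (kEq i j) (proj₁ (good v) i j p)
    rH≤R : rH H ≤ R
    rH≤R = ≤-reflexive (≡sym R≡)
    sf : StaleFree (rH H) (G t) (adj K') v
    sf a b ka ga h le = ¬true⇒false λ w → t≢f (walk-mono (adj K') (known (Ds v)) (eqB a) (eqB a) (λ c d q → trans (≡sym (kEq c d)) q) (λ _ z → z) h v w)
                                        (proj₂ (good v) a b (trans (≡sym (kEq a b)) ka) ga h (≤-trans le rH≤R))
    eqv : MemListCopy H (G t) v F ⇔ MemListCopy H K' v F
    eqv = memListCopy-stale-free H con (G t) K' v sub sf F
    at-v : MemListCopy H (G t) v F ⇔ MemListCopy H K' v F → MemListCopy H (G t) v F ⇔ MemListCopy H (deleteEdges (g0 s) (D s)) (me s) F
    at-v q rewrite StateIs.me≡ nkv | StateIs.g0≡ nkv = q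


n≤⌈n/2⌉+⌈n/2⌉ : ∀ n → n ≤ ⌈ n /2⌉ + ⌈ n /2⌉
n≤⌈n/2⌉+⌈n/2⌉ zero = z≤n
n≤⌈n/2⌉+⌈n/2⌉ (suc zero) = s≤s z≤n
n≤⌈n/2⌉+⌈n/2⌉ (suc (suc n)) = s≤s (≤-trans (s≤s (n≤⌈n/2⌉+⌈n/2⌉ n)) (≤-reflexive (≡sym (+-suc ⌈ n /2⌉ ⌈ n /2⌉))))

n≤2^⌈log2⌉ : ∀ n (ac : Acc _<_ n) → n ≤ 2 ^ ⌈log2⌉ n ac
n≤2^⌈log2⌉ zero _ = z≤n
n≤2^⌈log2⌉ (suc zero) _ = s≤s z≤n
n≤2^⌈log2⌉ (suc (suc n)) (accW rs) =
  ≤-trans (s≤s (≤-trans (s≤s (n≤⌈n/2⌉+⌈n/2⌉ n)) (≤-reflexive (≡sym (+-suc ⌈ n /2⌉ ⌈ n /2⌉)))))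
    (≤-trans (≤-reflexive (cong (suc ⌈ n /2⌉ +_) (≡sym (+-identityʳ (suc ⌈ n /2⌉)))))
      (*-monoʳ-≤ 2 (n≤2^⌈log2⌉ (suc ⌈ n /2⌉) (rs (⌈n/2⌉<n n)))))

n≤2^⌈log₂n⌉ : ∀ n → n ≤ 2 ^ ⌈log₂ n ⌉
n≤2^⌈log₂n⌉ n = n≤2^⌈log2⌉ n (<-wellFounded n)

⌈log₂⌉≥1 : ∀ n → 2 ≤ n → 1 ≤ ⌈log₂ n ⌉
⌈log₂⌉≥1 n le = ⌈log₂⌉-mono-≤ {2} {n} le

n<2^n : ∀ n → n < 2 ^ n
n<2^n zero = s≤s z≤n
n<2^n (suc n) = ≤-trans (s≤s (n<2^n n)) (≤-trans (≤-reflexive (+-comm 1 (2 ^ n))) (+-monoʳ-≤ (2 ^ n) (≤-trans (≤-trans (s≤s z≤n) (n<2^n n)) (≤-reflexive (≡sym (+-identityʳ _))))))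

packet-fits : ∀ L R m r c → 1 ≤ L → 1 ≤ m → L ≤ c * r → suc r ≤ R + m * suc R →
  suc (L + (L + R)) ≤ m * (2 * suc R * suc (suc (suc R)) * c)
packet-fits L R m r c L1 m1 Lc rm = begin
    suc (L + (L + R)) ≡⟨ eq0 L R ⟩
    L + L + suc R ≤⟨ +-monoʳ-≤ (L + L) (≤-trans (s≤s (≤-trans (≤-reflexive (≡sym (*-identityʳ R))) (*-monoʳ-≤ R L1))) (≤-reflexive refl)) ⟩
    L + L + suc (R * L) ≤⟨ +-monoʳ-≤ (L + L) (+-monoˡ-≤ (R * L) L1) ⟩
    L + L + (L + R * L) ≡⟨ eq1 L R ⟩
    suc (suc (suc R)) * L ≤⟨ *-monoʳ-≤ (suc (suc (suc R))) (≤-trans Lc (*-monoʳ-≤ c r2)) ⟩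
    suc (suc (suc R)) * (c * (2 * (m * suc R))) ≡⟨ eq2 R m c ⟩
    m * (2 * suc R * suc (suc (suc R)) * c) ∎
  where
  open ≤-Reasoning
  eq0 : ∀ L R → suc (L + (L + R)) ≡ L + L + suc R
  eq0 = solve-∀
  eq1 : ∀ L R → L + L + (L + R * L) ≡ suc (suc (suc R)) * L
  eq1 = solve-∀
  eq2 : ∀ R m c → suc (suc (suc R)) * (c * (2 * (m * suc R))) ≡ m * (2 * suc R * suc (suc (suc R)) * c)
  eq2 = solve-∀
  r2 : r ≤ 2 * (m * suc R)
  r2 = ≤-trans (n≤1+n r) (≤-trans rm (≤-trans (+-monoˡ-≤ (m * suc R) (≤-trans (n≤1+n R) (≤-trans (≤-reflexive (≡sym (*-identityˡ (suc R)))) (*-monoˡ-≤ (suc R) m1))))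
         (≤-reflexive (cong (m * suc R +_) (≡sym (+-identityʳ (m * suc R)))))))


silent : ∀ n → Algorithm n 0
silent n = record { State = ⊤ ; init = λ _ _ → tt ; send = λ _ _ _ → [] ; step = λ _ _ _ → tt ; out = λ _ _ → false }

no-edge : ∀ {n} → n ≤ 1 → (Gr : Graph n) → ∀ v u → adj Gr v u ≡ true → ⊥
no-edge {suc zero} _ Gr fz fz p = t≢f p (irrefl Gr fz)
no-edge {suc (suc n)} (s≤s ()) Gr v u p

silent-solves : ∀ {k} (H : Graph k) n → n ≤ 1 → ∀ r → SolvesMemList H r (silent n)
silent-solves H n le r G eds prom t e v F =
  mk⇔ (λ ()) (λ { (FG , (u , Fvu) , iso) → ⊥-elim (no-edge le (G t) v u (FG v u Fvu)) })

suc-pred : ∀ {x} → 1 ≤ x → suc (x ∸ 1) ≡ x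
suc-pred {suc x} _ = refl

m≤[m+n]/[1+n]*[1+n] : ∀ m n → m ≤ (m + n) / suc n * suc n
m≤[m+n]/[1+n]*[1+n] m n = +-cancelˡ-≤ n m ((m + n) / suc n * suc n) (begin
    n + m                               ≡⟨ +-comm n m ⟩
    m + n                               ≡⟨ m≡m%n+[m/n]*n (m + n) (suc n) ⟩
    (m + n) % suc n + (m + n) / suc n * suc n ≤⟨ +-monoˡ-≤ _ (≤-pred (m%n<n (m + n) (suc n))) ⟩
    n + (m + n) / suc n * suc n         ∎)
  where open ≤-Reasoning

m≤n+m/[1+n]*[1+n] : ∀ m n → m ≤ n + m / suc n * suc n
m≤n+m/[1+n]*[1+n] m n = ≤-trans (≤-reflexive (m≡m%n+[m/n]*n m (suc n))) (+-monoˡ-≤ _ (≤-pred (m%n<n m (suc n))))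

bandwidthConstant : ℕ → ℕ
bandwidthConstant R = 2 * suc R * suc (suc (suc R))

-- For the round budget r+1, a packet travels one hop per phase of m = ⌊(r+2)/(R+1)⌋ rounds, R = rH H:
-- a deletion waits less than one phase and is then flooded over R hops, all within r+1 rounds.
-- A packet (flag, two IDs, hop count) has 2⌈log₂ n⌉ + R + 1 bits, i.e. O(⌈log₂ n⌉/r) bits per round.
memList-algorithm : ∀ {k} (H : Graph k) → Connected H → 1 ≤ rH H → ∀ n r → rH H ≤ suc r →
  Σ (Algorithm (suc (suc n)) (bandwidthConstant (suc (rH H ∸ 1)) * ceilDiv ⌈log₂ suc (suc n) ⌉ (suc r)))
    (SolvesMemList H (suc r))
memList-algorithm H con rH-pos n r rH≤ = Protocol.algorithm H N L R B (m ∸ 1) R' , solves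
  where
  N = suc (suc n)
  L = ⌈log₂ N ⌉
  R' = rH H ∸ 1
  R = suc R'
  R≡ : R ≡ rH H
  R≡ = suc-pred rH-pos
  B = bandwidthConstant R * ceilDiv L (suc r)
  m = suc (suc r) / suc R
  m≥1 : 1 ≤ m
  m≥1 = m≥n⇒m/n>0 (s≤s (≤-trans (≤-reflexive R≡) rH≤))
  fits : suc (L + (L + R)) ≤ suc (m ∸ 1) * B
  fits = subst (λ z → suc (L + (L + R)) ≤ z * B) (≡sym (suc-pred m≥1))
           (packet-fits L R m (suc r) (ceilDiv L (suc r)) (⌈log₂⌉≥1 N (s≤s (s≤s z≤n))) m≥1
             (m≤[m+n]/[1+n]*[1+n] L r) (m≤n+m/[1+n]*[1+n] (suc (suc r)) R))
  decodes : ∀ a b h → h ≤ R → Codec.decode N L R B (Codec.chunksUpTo N L R B (just (a , b , h)) (suc (m ∸ 1))) ≡ just (a , b , h)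
  decodes a b h h≤R = Codec.decode-chunksUpTo N L R B (suc (m ∸ 1)) (n≤2^⌈log₂n⌉ N) fits a b h (≤-<-trans h≤R (n<2^n R))
  timing : suc R * suc (m ∸ 1) ≤ suc (suc r)
  timing = subst (λ z → suc R * z ≤ suc (suc r)) (≡sym (suc-pred m≥1))
             (≤-trans (≤-reflexive (*-comm (suc R) m)) (m/n*n≤m (suc (suc r)) (suc R)))
  solves : SolvesMemList H (suc r) (Protocol.algorithm H N L R B (m ∸ 1) R')
  solves G eds prom = Execution.output-correct H con N L R B (m ∸ 1) R' (suc r) R≡ decodes timing G eds prom

theorem5p10 : ∀ {k} (H : Graph k) → Connected H → 3 ≤ k →
    Σ ℕ λ C →
    ∀ (n r : ℕ) → rH H ≤ r →
    Σ ℕ λ B → B ≤ C * ceilDiv ⌈log₂ n ⌉ r ×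
    Σ (Algorithm n B) λ A → SolvesMemList H r A
theorem5p10 H con k≥3 = bandwidthConstant (suc (rH H ∸ 1)) , bandwidth
  where
  bandwidth : ∀ n r → rH H ≤ r → Σ ℕ λ B → B ≤ bandwidthConstant (suc (rH H ∸ 1)) * ceilDiv ⌈log₂ n ⌉ r ×
    Σ (Algorithm n B) λ A → SolvesMemList H r A
  bandwidth zero r _ = 0 , z≤n , silent 0 , silent-solves H 0 z≤n r
  bandwidth (suc zero) r _ = 0 , z≤n , silent 1 , silent-solves H 1 ≤-refl r
  bandwidth (suc (suc n)) zero rH≤0 = ⊥-elim (<-irrefl refl (≤-trans (rH≥1 H con k≥3) rH≤0))
  bandwidth (suc (suc n)) (suc r) rH≤ = _ , ≤-refl , memList-algorithm H con (rH≥1 H con k≥3) n r rH≤
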